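{- For every $n\ge0$ and indeterminates $\alpha, c$, \[\sum_F c^{\,\mathrm{tree}\,F}\prod_{v\in[n]}\left(1+\frac{\alpha}{h_F(v)}\right)=P_n\bigl(1,1+\alpha,c(1+\alpha)\bigr),\] where $F$ runs over all forests of rooted trees on the vertex set $[n]$, $\mathrm{tree}\,F$ is the number of trees of $F$, and $h_F(v)$ is the hook length of $v$ in $F$.
   Context: $P_n(a,b,c)=c\prod_{i=1}^{n-1}(ia+(n-i)b+c)$ for $n\ge1$, and $P_0=1$. The hook length $h(v)$ of a vertex $v$ is the number of descendants of $v$ (vertices $w$ such that $v$ lies on the path from the root to $w$), including $v$. -}

module Defs where

open import Data.Nat as ℕ using (ℕ; zero; suc; _∸_)
open import Data.Fin using (Fin; _≟_)
open import Data.Maybe using (Maybe; just; nothing)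
open import Data.Maybe.Properties using (≡-dec)
open import Data.Vec as Vec using (Vec; []; _∷_; lookup)
open import Data.List as List using (List; []; _∷_; map; concatMap; filter; length; allFin; applyUpTo; foldr; upTo)
open import Data.Integer using (+_)
open import Data.Rational using (ℚ; _+_; _*_; _/_; 0ℚ; 1ℚ)
open import Data.Bool using (Bool; true; false; if_then_else_)
open import Relation.Nullary using (Dec; yes; no; ¬_)
open import Relation.Nullary.Decidable using (⌊_⌋)
open import Relation.Binary.PropositionalEquality using (_≡_)
open import Data.Bool.ListAction using (all; any)

-- A forest of rooted trees on vertex set [n] = Fin n, encoded by its parent map:
-- (lookup F v) is the parent of v, or nothing if v is a root.
ParentMap : ℕ → Set
ParentMap n = Vec (Maybe (Fin n)) n

allVecs : {A : Set} → List A → (k : ℕ) → List (Vec A k)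
allVecs xs zero = [] ∷ []
allVecs xs (suc k) = concatMap (λ x → map (x ∷_) (allVecs xs k)) xs

allMaybeFin : (n : ℕ) → List (Maybe (Fin n))
allMaybeFin n = nothing ∷ map just (allFin n)

anc : {n : ℕ} → ParentMap n → ℕ → Fin n → Maybe (Fin n)
anc F zero v = just v
anc F (suc k) v with anc F k v
... | nothing = nothing
... | just u = lookup F u

-- parent map is acyclic (every vertex reaches a root), i.e. it encodes a forest
isForest : {n : ℕ} → ParentMap n → Set
isForest {n} F = (v : Fin n) → anc F n v ≡ nothing

isForest? : {n : ℕ} (F : ParentMap n) → Bool
isForest? {n} F = all (λ v → ⌊ ≡-dec _≟_ (anc F n v) nothing ⌋) (allFin n)

forests : (n : ℕ) → List (ParentMap n)
forests n = filter (λ F → Data.Bool._≟_ (isForest? F) true) (allVecs (allMaybeFin n) n)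
  where import Data.Bool

count : {n : ℕ} → (Fin n → Bool) → ℕ
count {n} P = length (List.filter (λ v → Data.Bool._≟_ (P v) true) (allFin n))
  where import Data.Bool

tree : {n : ℕ} → ParentMap n → ℕ
tree F = count (λ v → ⌊ ≡-dec _≟_ (lookup F v) nothing ⌋)

properDesc : {n : ℕ} → ParentMap n → Fin n → Fin n → Bool
properDesc {n} F v w = any (λ k → ⌊ ≡-dec _≟_ (anc F k w) (just v) ⌋) (applyUpTo suc n)

hook : {n : ℕ} → ParentMap n → Fin n → ℕ
hook F v = suc (count (properDesc F v))

ℕ→ℚ : ℕ → ℚ
ℕ→ℚ k = (+ k) / 1

_^_ : ℚ → ℕ → ℚ
x ^ zero = 1ℚ
x ^ suc k = x * (x ^ k)

sumℚ : List ℚ → ℚ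
sumℚ = foldr _+_ 0ℚ

prodℚ : List ℚ → ℚ
prodℚ = foldr _*_ 1ℚ

P : ℕ → ℚ → ℚ → ℚ → ℚ
P zero a b c = 1ℚ
P (suc m) a b c =
  c * prodℚ (map (λ i → ℕ→ℚ i * a + ℕ→ℚ (suc m ∸ i) * b + c) (applyUpTo suc m))

summand : {n : ℕ} → ℚ → ℚ → ParentMap n → ℚ
summand {n} α c F =
  (c ^ tree F) * prodℚ (map (λ v → 1ℚ + α * ((+ 1) / hook F v)) (allFin n))

LHS : (n : ℕ) → ℚ → ℚ → ℚ
LHS n α c = sumℚ (map (summand α c) (forests n))

{-# OPTIONS --safe #-}
-- Replace c ^ tree F by d · y ^ (tree F − 1) and let Z_n(d, y) be the resulting weighted sum over
-- the forests on [n]. The hooks of the roots of a forest add up to n, so n · Z_n counts every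
-- forest once for each of its roots v, with multiplicity hook(v). Deleting a root v leaves a forest
-- G on the other vertices together with the set M of roots of G that were children of v: all other
-- hooks are unchanged, hook(v) (1 + α / hook(v)) = hook(v) + α, and hook(v) − 1 is the number of
-- vertices below M. Summing over M gives
--   Z_{n+1}(d, y) = d Σ_G W(G) ((1 + α)(1 + y)^{tree G} + n (1 + y)^{tree G − 1}),
-- with W the hook product, hence Z_{m+2}(d, y) = d ((1 + α)(1 + y) + m + 1) Z_{m+1}(1, 1 + y).
-- Unfolding this recursion from Z_1(d, y) = d (1 + α) produces the factors of P_{m+1}.
module Submission where

open import Defs
open import Data.Nat using (ℕ)
open import Data.Rational using (ℚ; _+_; _*_; 1ℚ)
open import Relation.Binary.PropositionalEquality using (_≡_)

open import Data.Nat as ℕ using (zero; suc; _≤_; _<_; z≤n; s≤s; _∸_)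
import Data.Nat.Properties as ℕP
import Data.Nat.ListAction as ℕ
import Data.Nat.Coprimality as Coprime
open import Data.Integer as ℤ using ()
import Data.Integer.Solver
open import Data.Rational as ℚ using (0ℚ; mkℚ; _/_; toℚᵘ)
import Data.Rational.Properties as ℚP
import Data.Rational.Unnormalised as ℚᵘ
import Data.Rational.Unnormalised.Properties as ℚᵘP
open import Data.Rational.Solver using (module +-*-Solver)
open +-*-Solver
open import Data.Fin as Fin using (Fin; zero; suc; toℕ; punchIn; punchOut)
import Data.Fin.Properties as FinP
open import Data.Maybe using (Maybe; just; nothing; _>>=_; fromMaybe)
import Data.Maybe.Properties as MaybeP
open import Data.Vec as Vec using (Vec; []; _∷_; lookup; insertAt; zipWith)
import Data.Vec.Properties as VecP
import Data.Vec.Functional as VF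
open import Data.List as List using (List; []; _∷_; map; _++_; concatMap; filter; length; allFin; applyUpTo; tabulate)
import Data.List.Properties as ListP
import Data.List.Relation.Unary.All.Properties as AllP
import Data.List.Relation.Unary.Any.Properties as AnyP
open import Data.Bool as Bool using (Bool; true; false; _∧_; not)
open import Data.Bool.Properties using (T-≡)
open import Data.Product using (_×_; _,_; proj₁; proj₂; ∃)
open import Data.Empty using (⊥; ⊥-elim)
open import Relation.Nullary using (Dec; yes; no; ¬_)
open import Relation.Nullary.Decidable using (⌊_⌋; dec-true; dec-false; isYes≗does; toWitness; fromWitness)
open import Relation.Binary.PropositionalEquality
open import Relation.Binary.Definitions using (tri<; tri≈; tri>)
open import Function using (_∘_)
open import Function.Bundles using (Equivalence)
import Algebra.Properties.CommutativeMonoid.Sum as MonoidSum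

ℕ→ℚ≡mkℚ : ∀ k → ℕ→ℚ k ≡ mkℚ (ℤ.+ k) 0 (Coprime.sym (Coprime.1-coprimeTo k))
ℕ→ℚ≡mkℚ k = ℚP.normalize-coprime (Coprime.sym (Coprime.1-coprimeTo k))

ℕ→ℚ-suc : ∀ k → ℕ→ℚ (suc k) ≡ 1ℚ + ℕ→ℚ k
ℕ→ℚ-suc k = ℚP.toℚᵘ-injective (begin-equality
    toℚᵘ (ℕ→ℚ (suc k))
  ≡⟨ cong toℚᵘ (ℕ→ℚ≡mkℚ (suc k)) ⟩
    ℚᵘ.mkℚᵘ (ℤ.+ suc k) 0
  ≃⟨ ℚᵘ.*≡* (Z.solve 1 (λ x → (Z.con (ℤ.+ 1) Z.:+ x) Z.:* Z.con (ℤ.+ 1)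
                         Z.:= (Z.con (ℤ.+ 1) Z.:* Z.con (ℤ.+ 1) Z.:+ x Z.:* Z.con (ℤ.+ 1)) Z.:* Z.con (ℤ.+ 1))
                 refl (ℤ.+ k)) ⟩
    toℚᵘ 1ℚ ℚᵘ.+ ℚᵘ.mkℚᵘ (ℤ.+ k) 0
  ≡⟨ cong (λ z → toℚᵘ 1ℚ ℚᵘ.+ toℚᵘ z) (sym (ℕ→ℚ≡mkℚ k)) ⟩
    toℚᵘ 1ℚ ℚᵘ.+ toℚᵘ (ℕ→ℚ k)
  ≃⟨ ℚᵘP.≃-sym (ℚP.toℚᵘ-homo-+ 1ℚ (ℕ→ℚ k)) ⟩
    toℚᵘ (1ℚ + ℕ→ℚ k)
  ∎)
  where
  open ℚᵘP.≤-Reasoning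
  module Z = Data.Integer.Solver.+-*-Solver

ℕ→ℚ-suc-*-inverse : ∀ h → ℕ→ℚ (suc h) * ((ℤ.+ 1) / suc h) ≡ 1ℚ
ℕ→ℚ-suc-*-inverse h
  rewrite ℕ→ℚ≡mkℚ (suc h) | ℚP.normalize-coprime (Coprime.1-coprimeTo (suc h))
  = ℚP.*-inverseʳ (mkℚ (ℤ.+ suc h) 0 (Coprime.sym (Coprime.1-coprimeTo (suc h))))

ℕ→ℚ-suc-*-cancelˡ : ∀ n {a b} → ℕ→ℚ (suc n) * a ≡ ℕ→ℚ (suc n) * b → a ≡ b
ℕ→ℚ-suc-*-cancelˡ n {a} {b} eq rewrite ℕ→ℚ≡mkℚ (suc n) = begin
    a
  ≡⟨ sym (cancel a) ⟩
    ℚ.1/ p * (p * a)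
  ≡⟨ cong (ℚ.1/ p *_) eq ⟩
    ℚ.1/ p * (p * b)
  ≡⟨ cancel b ⟩
    b
  ∎ where
  open ≡-Reasoning
  p = mkℚ (ℤ.+ suc n) 0 (Coprime.sym (Coprime.1-coprimeTo (suc n)))
  cancel : ∀ x → ℚ.1/ p * (p * x) ≡ x
  cancel x = trans (sym (ℚP.*-assoc (ℚ.1/ p) p x))
                   (trans (cong (_* x) (ℚP.*-inverseˡ p)) (ℚP.*-identityˡ x))

-- Finite sums and products

∑ : {A : Set} → List A → (A → ℚ) → ℚ
∑ xs f = sumℚ (map f xs)

∏ : {A : Set} → List A → (A → ℚ) → ℚ
∏ xs f = prodℚ (map f xs)

syntax ∑ xs (λ x → e) = ∑[ x ∈ xs ] e
syntax ∏ xs (λ x → e) = ∏[ x ∈ xs ] e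

⌊⌋-true : {P : Set} (P? : Dec P) → P → ⌊ P? ⌋ ≡ true
⌊⌋-true P? p = trans (isYes≗does P?) (dec-true P? p)

⌊⌋-false : {P : Set} (P? : Dec P) → ¬ P → ⌊ P? ⌋ ≡ false
⌊⌋-false P? ¬p = trans (isYes≗does P?) (dec-false P? ¬p)

⌊⌋-true⁻¹ : {P : Set} (P? : Dec P) → ⌊ P? ⌋ ≡ true → P
⌊⌋-true⁻¹ P? e = toWitness (Equivalence.from T-≡ e)

Bool-ext : {a b : Bool} → (a ≡ true → b ≡ true) → (b ≡ true → a ≡ true) → a ≡ b
Bool-ext {false} {false} _ _ = refl
Bool-ext {false} {true} _ b⇒a = b⇒a refl
Bool-ext {true} {false} a⇒b _ = sym (a⇒b refl)
Bool-ext {true} {true} _ _ = refl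

𝟙 : Bool → ℚ
𝟙 true = 1ℚ
𝟙 false = 0ℚ

private variable
  A B C : Set


∑-cong : (xs : List A) {f g : A → ℚ} → (∀ x → f x ≡ g x) → ∑ xs f ≡ ∑ xs g
∑-cong [] f≗g = refl
∑-cong (x ∷ xs) f≗g = cong₂ _+_ (f≗g x) (∑-cong xs f≗g)

∏-cong : (xs : List A) {f g : A → ℚ} → (∀ x → f x ≡ g x) → ∏ xs f ≡ ∏ xs g
∏-cong [] f≗g = refl
∏-cong (x ∷ xs) f≗g = cong₂ _*_ (f≗g x) (∏-cong xs f≗g)

∑-++ : (xs ys : List A) (f : A → ℚ) → ∑ (xs ++ ys) f ≡ ∑ xs f + ∑ ys f
∑-++ [] ys f = sym (ℚP.+-identityˡ _)
∑-++ (x ∷ xs) ys f = trans (cong (f x +_) (∑-++ xs ys f)) (sym (ℚP.+-assoc (f x) _ _))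

∏-++ : (xs ys : List A) (f : A → ℚ) → ∏ (xs ++ ys) f ≡ ∏ xs f * ∏ ys f
∏-++ [] ys f = sym (ℚP.*-identityˡ _)
∏-++ (x ∷ xs) ys f = trans (cong (f x *_) (∏-++ xs ys f)) (sym (ℚP.*-assoc (f x) _ _))

∑-map : (g : B → A) (xs : List B) (f : A → ℚ) → ∑ (map g xs) f ≡ ∑ xs (f ∘ g)
∑-map g [] f = refl
∑-map g (x ∷ xs) f = cong (f (g x) +_) (∑-map g xs f)

∑-concatMap : (g : B → List A) (xs : List B) (f : A → ℚ) →
  ∑ (concatMap g xs) f ≡ ∑[ x ∈ xs ] ∑ (g x) f
∑-concatMap g [] f = refl
∑-concatMap g (x ∷ xs) f = trans (∑-++ (g x) (concatMap g xs) f) (cong (∑ (g x) f +_) (∑-concatMap g xs f))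

∑-zero : (xs : List A) {f : A → ℚ} → (∀ x → f x ≡ 0ℚ) → ∑ xs f ≡ 0ℚ
∑-zero [] f≡0 = refl
∑-zero (x ∷ xs) f≡0 = trans (cong₂ _+_ (f≡0 x) (∑-zero xs f≡0)) (ℚP.+-identityˡ 0ℚ)

∑-const : (xs : List A) (a : ℚ) → ∑[ _ ∈ xs ] a ≡ ℕ→ℚ (length xs) * a
∑-const [] a = sym (ℚP.*-zeroˡ a)
∑-const (x ∷ xs) a = begin
    a + ∑[ _ ∈ xs ] a
  ≡⟨ cong (a +_) (∑-const xs a) ⟩
    a + ℕ→ℚ (length xs) * a
  ≡⟨ solve 2 (λ a l → a :+ l :* a := (con 1ℚ :+ l) :* a) refl a (ℕ→ℚ (length xs)) ⟩
    (1ℚ + ℕ→ℚ (length xs)) * a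
  ≡⟨ cong (_* a) (sym (ℕ→ℚ-suc (length xs))) ⟩
    ℕ→ℚ (length (x ∷ xs)) * a
  ∎ where open ≡-Reasoning

∑-distrib-+ : (xs : List A) (f g : A → ℚ) → ∑[ x ∈ xs ] (f x + g x) ≡ ∑ xs f + ∑ xs g
∑-distrib-+ [] f g = refl
∑-distrib-+ (x ∷ xs) f g = trans (cong ((f x + g x) +_) (∑-distrib-+ xs f g))
  (solve 4 (λ a b c d → (a :+ b) :+ (c :+ d) := (a :+ c) :+ (b :+ d)) refl (f x) (g x) (∑ xs f) (∑ xs g))

*-distribˡ-∑ : (a : ℚ) (xs : List A) (f : A → ℚ) → a * ∑ xs f ≡ ∑[ x ∈ xs ] (a * f x)
*-distribˡ-∑ a [] f = ℚP.*-zeroʳ a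
*-distribˡ-∑ a (x ∷ xs) f = trans (ℚP.*-distribˡ-+ a (f x) _) (cong (a * f x +_) (*-distribˡ-∑ a xs f))

*-distribʳ-∑ : (a : ℚ) (xs : List A) (f : A → ℚ) → ∑ xs f * a ≡ ∑[ x ∈ xs ] (f x * a)
*-distribʳ-∑ a xs f = begin
    ∑ xs f * a              ≡⟨ ℚP.*-comm (∑ xs f) a ⟩
    a * ∑ xs f              ≡⟨ *-distribˡ-∑ a xs f ⟩
    ∑[ x ∈ xs ] (a * f x)   ≡⟨ ∑-cong xs (λ x → ℚP.*-comm a (f x)) ⟩
    ∑[ x ∈ xs ] (f x * a)   ∎
  where open ≡-Reasoning

∑-comm : (xs : List A) (ys : List B) (f : A → B → ℚ) →
  ∑[ x ∈ xs ] ∑[ y ∈ ys ] f x y ≡ ∑[ y ∈ ys ] ∑[ x ∈ xs ] f x y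
∑-comm [] ys f = sym (∑-zero ys (λ _ → refl))
∑-comm (x ∷ xs) ys f = trans (cong (∑ ys (f x) +_) (∑-comm xs ys f))
  (sym (∑-distrib-+ ys (f x) (λ y → ∑[ x ∈ xs ] f x y)))

∑-filter : (p : A → Bool) (xs : List A) (f : A → ℚ) →
  ∑ (filter (λ x → p x Bool.≟ true) xs) f ≡ ∑[ x ∈ xs ] (𝟙 (p x) * f x)
∑-filter p [] f = refl
∑-filter p (x ∷ xs) f with p x
... | true = cong₂ _+_ (sym (ℚP.*-identityˡ (f x))) (∑-filter p xs f)
... | false = trans (∑-filter p xs f) (sym (trans (cong (_+ _) (ℚP.*-zeroˡ (f x))) (ℚP.+-identityˡ _)))

𝟙-* : (b : Bool) (x y : ℚ) → (b ≡ true → x ≡ y) → 𝟙 b * x ≡ 𝟙 b * y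
𝟙-* true x y x≡y = cong (1ℚ *_) (x≡y refl)
𝟙-* false x y _ = trans (ℚP.*-zeroˡ x) (sym (ℚP.*-zeroˡ y))

foldr-map-allFin : (_∙_ : A → B → B) (e : B) {n : ℕ} (f : Fin n → A) →
  List.foldr _∙_ e (map f (allFin n)) ≡ VF.foldr _∙_ e f
foldr-map-allFin _∙_ e {zero} f = refl
foldr-map-allFin _∙_ e {suc n} f = cong (f zero ∙_) (begin
    List.foldr _∙_ e (map f (tabulate suc))
  ≡⟨ cong (List.foldr _∙_ e) (ListP.map-tabulate suc f) ⟩
    List.foldr _∙_ e (tabulate (f ∘ suc))
  ≡⟨ cong (List.foldr _∙_ e) (sym (ListP.map-tabulate (λ i → i) (f ∘ suc))) ⟩
    List.foldr _∙_ e (map (f ∘ suc) (allFin n))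
  ≡⟨ foldr-map-allFin _∙_ e (f ∘ suc) ⟩
    VF.foldr _∙_ e (f ∘ suc)
  ∎)
  where open ≡-Reasoning

private
  module ℚ+ = MonoidSum ℚP.+-0-commutativeMonoid
  module ℚ* = MonoidSum ℚP.*-1-commutativeMonoid
  module ℕ+ = MonoidSum ℕP.+-0-commutativeMonoid

∑-allFin-remove : ∀ {n} (i : Fin (suc n)) (f : Fin (suc n) → ℚ) →
  ∑[ u ∈ allFin (suc n) ] f u ≡ f i + ∑[ u ∈ allFin n ] f (punchIn i u)
∑-allFin-remove i f = begin
    ∑ (allFin _) f                   ≡⟨ foldr-map-allFin _+_ 0ℚ f ⟩
    ℚ+.sum f                         ≡⟨ ℚ+.sum-remove {i = i} f ⟩
    f i + ℚ+.sum (f ∘ punchIn i)     ≡⟨ cong (f i +_) (foldr-map-allFin _+_ 0ℚ (f ∘ punchIn i)) ⟨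
    f i + ∑ (allFin _) (f ∘ punchIn i) ∎
  where open ≡-Reasoning

∏-allFin-remove : ∀ {n} (i : Fin (suc n)) (f : Fin (suc n) → ℚ) →
  ∏[ u ∈ allFin (suc n) ] f u ≡ f i * ∏[ u ∈ allFin n ] f (punchIn i u)
∏-allFin-remove i f = begin
    ∏ (allFin _) f                   ≡⟨ foldr-map-allFin _*_ 1ℚ f ⟩
    ℚ*.sum f                         ≡⟨ ℚ*.sum-remove {i = i} f ⟩
    f i * ℚ*.sum (f ∘ punchIn i)     ≡⟨ cong (f i *_) (foldr-map-allFin _*_ 1ℚ (f ∘ punchIn i)) ⟨
    f i * ∏ (allFin _) (f ∘ punchIn i) ∎
  where open ≡-Reasoning

∑-allFin-const : ∀ n (a : ℚ) → ∑[ _ ∈ allFin n ] a ≡ ℕ→ℚ n * a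
∑-allFin-const n a = trans (∑-const (allFin n) a) (cong (λ l → ℕ→ℚ l * a) (ListP.length-tabulate {n = n} (λ i → i)))

∑-allFin-δ : ∀ {n} (i : Fin n) (f : Fin n → ℚ) → ∑[ u ∈ allFin n ] (f u * 𝟙 ⌊ i Fin.≟ u ⌋) ≡ f i
∑-allFin-δ {suc n} i f = begin
    ∑[ u ∈ allFin (suc n) ] (f u * 𝟙 ⌊ i Fin.≟ u ⌋)
  ≡⟨ ∑-allFin-remove i (λ u → f u * 𝟙 ⌊ i Fin.≟ u ⌋) ⟩
    f i * 𝟙 ⌊ i Fin.≟ i ⌋ + ∑[ u ∈ allFin n ] (f (punchIn i u) * 𝟙 ⌊ i Fin.≟ punchIn i u ⌋)
  ≡⟨ cong₂ (λ b s → f i * 𝟙 b + s) (⌊⌋-true (i Fin.≟ i) refl) (∑-zero (allFin n) off-diagonal) ⟩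
    f i * 1ℚ + 0ℚ
  ≡⟨ trans (ℚP.+-identityʳ _) (ℚP.*-identityʳ _) ⟩
    f i
  ∎ where
  open ≡-Reasoning
  off-diagonal : ∀ u → f (punchIn i u) * 𝟙 ⌊ i Fin.≟ punchIn i u ⌋ ≡ 0ℚ
  off-diagonal u = trans (cong (λ b → f (punchIn i u) * 𝟙 b) (⌊⌋-false (i Fin.≟ punchIn i u) (FinP.punchInᵢ≢i i u ∘ sym)))
                         (ℚP.*-zeroʳ (f (punchIn i u)))

bit : Bool → ℕ
bit true = 1
bit false = 0

length-filter≡sum-bit : (p : A → Bool) (xs : List A) →
  length (filter (λ x → p x Bool.≟ true) xs) ≡ ℕ.sum (map (bit ∘ p) xs)
length-filter≡sum-bit p [] = refl
length-filter≡sum-bit p (x ∷ xs) with p x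
... | true = cong suc (length-filter≡sum-bit p xs)
... | false = length-filter≡sum-bit p xs

count≡sum-bit : ∀ {n} (P : Fin n → Bool) → count P ≡ ℕ+.sum (bit ∘ P)
count≡sum-bit P = trans (length-filter≡sum-bit P (allFin _)) (foldr-map-allFin ℕ._+_ 0 (bit ∘ P))

count-remove : ∀ {n} (i : Fin (suc n)) (P : Fin (suc n) → Bool) → count P ≡ bit (P i) ℕ.+ count (P ∘ punchIn i)
count-remove i P = begin
    count P                               ≡⟨ count≡sum-bit P ⟩
    ℕ+.sum (bit ∘ P)                      ≡⟨ ℕ+.sum-remove {i = i} (bit ∘ P) ⟩
    bit (P i) ℕ.+ ℕ+.sum (bit ∘ P ∘ punchIn i) ≡⟨ cong (bit (P i) ℕ.+_) (count≡sum-bit (P ∘ punchIn i)) ⟨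
    bit (P i) ℕ.+ count (P ∘ punchIn i)   ∎
  where open ≡-Reasoning

count-cong : ∀ {n} {P Q : Fin n → Bool} → (∀ u → P u ≡ Q u) → count P ≡ count Q
count-cong {P = P} {Q} P≗Q = begin
    count P            ≡⟨ count≡sum-bit P ⟩
    ℕ+.sum (bit ∘ P)   ≡⟨ ℕ+.sum-cong-≗ (cong bit ∘ P≗Q) ⟩
    ℕ+.sum (bit ∘ Q)   ≡⟨ count≡sum-bit Q ⟨
    count Q            ∎
  where open ≡-Reasoning

count-pos : ∀ {n} (P : Fin n → Bool) (i : Fin n) → P i ≡ true → ∃ λ k → count P ≡ suc k
count-pos {suc n} P i Pi = count (P ∘ punchIn i) , trans (count-remove i P) (cong (λ b → bit b ℕ.+ count (P ∘ punchIn i)) Pi)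

ℕ→ℚ-count : ∀ {n} (P : Fin n → Bool) → ℕ→ℚ (count P) ≡ ∑[ u ∈ allFin n ] 𝟙 (P u)
ℕ→ℚ-count {n} P = begin
    ℕ→ℚ (length ps)
  ≡⟨ sym (ℚP.*-identityʳ _) ⟩
    ℕ→ℚ (length ps) * 1ℚ
  ≡⟨ sym (∑-const ps 1ℚ) ⟩
    ∑[ _ ∈ ps ] 1ℚ
  ≡⟨ ∑-filter P (allFin n) (λ _ → 1ℚ) ⟩
    ∑[ u ∈ allFin n ] (𝟙 (P u) * 1ℚ)
  ≡⟨ ∑-cong (allFin n) (λ u → ℚP.*-identityʳ (𝟙 (P u))) ⟩
    ∑[ u ∈ allFin n ] 𝟙 (P u)
  ∎ where
  open ≡-Reasoning
  ps = filter (λ u → P u Bool.≟ true) (allFin n)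

-- Ancestors in a parent map

just≢nothing : {x : A} → just x ≢ nothing
just≢nothing ()

module _ {n : ℕ} (F : ParentMap n) where

  anc-suc : ∀ k u → anc F (suc k) u ≡ (anc F k u >>= lookup F)
  anc-suc k u with anc F k u
  ... | nothing = refl
  ... | just _ = refl

  anc-+ : ∀ j k u → anc F (j ℕ.+ k) u ≡ (anc F k u >>= anc F j)
  anc-+ zero k u with anc F k u
  ... | nothing = refl
  ... | just _ = refl
  anc-+ (suc j) k u = begin
      anc F (suc (j ℕ.+ k)) u            ≡⟨ anc-suc (j ℕ.+ k) u ⟩
      (anc F (j ℕ.+ k) u >>= lookup F)   ≡⟨ cong (_>>= lookup F) (anc-+ j k u) ⟩
      ((anc F k u >>= anc F j) >>= lookup F) ≡⟨ bind-suc (anc F k u) ⟩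
      (anc F k u >>= anc F (suc j))      ∎
    where
    open ≡-Reasoning
    bind-suc : ∀ m → ((m >>= anc F j) >>= lookup F) ≡ (m >>= anc F (suc j))
    bind-suc nothing = refl
    bind-suc (just x) = sym (anc-suc j x)

  anc-nothing-mono : ∀ {k k′} u → k ≤ k′ → anc F k u ≡ nothing → anc F k′ u ≡ nothing
  anc-nothing-mono {k} {k′} u k≤k′ ended = begin
      anc F k′ u                         ≡⟨ cong (λ ℓ → anc F ℓ u) (ℕP.m∸n+n≡m k≤k′) ⟨
      anc F ((k′ ∸ k) ℕ.+ k) u           ≡⟨ anc-+ (k′ ∸ k) k u ⟩
      (anc F k u >>= anc F (k′ ∸ k))     ≡⟨ cong (_>>= anc F (k′ ∸ k)) ended ⟩
      nothing                            ∎
    where open ≡-Reasoning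

  root-anc-suc : ∀ r → lookup F r ≡ nothing → ∀ i → anc F (suc i) r ≡ nothing
  root-anc-suc r isRoot i = anc-nothing-mono {1} {suc i} r (s≤s z≤n) isRoot

  anc-shift : ∀ t {i j} u → anc F i u ≡ anc F j u → anc F (t ℕ.+ i) u ≡ anc F (t ℕ.+ j) u
  anc-shift t {i} {j} u same = begin
      anc F (t ℕ.+ i) u           ≡⟨ anc-+ t i u ⟩
      (anc F i u >>= anc F t)     ≡⟨ cong (_>>= anc F t) same ⟩
      (anc F j u >>= anc F t)     ≡⟨ anc-+ t j u ⟨
      anc F (t ℕ.+ j) u           ∎
    where open ≡-Reasoning

  -- Pigeonhole: if the first n steps of the chain from u stayed in Fin n, some vertex repeats, and
  -- then the chain is periodic and never ends.
  anc-depth-bound : ∀ u → anc F (suc n) u ≡ nothing → anc F n u ≡ nothing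
  anc-depth-bound u ended = from (anc F n u) refl
    where
    from : ∀ m → anc F n u ≡ m → anc F n u ≡ nothing
    from nothing eq = eq
    from (just x) eq = ⊥-elim (repetition⇒alive (FinP.pigeonhole (ℕP.n<1+n n) vertexAt))
      where
      alive : ∀ ℓ → ℓ ≤ n → anc F ℓ u ≢ nothing
      alive ℓ ℓ≤n dead = just≢nothing (trans (sym eq) (anc-nothing-mono u ℓ≤n dead))
      vertexAt : Fin (suc n) → Fin n
      vertexAt ℓ = fromMaybe x (anc F (toℕ ℓ) u)
      anc≡vertexAt : ∀ ℓ → anc F (toℕ ℓ) u ≡ just (vertexAt ℓ)
      anc≡vertexAt ℓ with anc F (toℕ ℓ) u | alive (toℕ ℓ) (ℕP.≤-pred (FinP.toℕ<n ℓ))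
      ... | just _ | _ = refl
      ... | nothing | alive-ℓ = ⊥-elim (alive-ℓ refl)
      repetition⇒alive : (∃ λ i → ∃ λ j → i Fin.< j × vertexAt i ≡ vertexAt j) → ⊥
      repetition⇒alive (i , j , i<j , same) = alive (t ℕ.+ toℕ i) t+i≤n (trans (sym cycle) ended)
        where
        j≤n : toℕ j ≤ n
        j≤n = ℕP.≤-pred (FinP.toℕ<n j)
        t = suc n ∸ toℕ j
        cycle : anc F (suc n) u ≡ anc F (t ℕ.+ toℕ i) u
        cycle = trans (cong (λ ℓ → anc F ℓ u) (sym (ℕP.m∸n+n≡m (ℕP.m≤n⇒m≤1+n j≤n))))
                      (anc-shift t u (trans (anc≡vertexAt j) (trans (cong just (sym same)) (sym (anc≡vertexAt i)))))
        t+i≤n : t ℕ.+ toℕ i ≤ n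
        t+i≤n = ℕP.≤-pred (begin-strict
            t ℕ.+ toℕ i   <⟨ ℕP.+-monoʳ-< t i<j ⟩
            t ℕ.+ toℕ j   ≡⟨ ℕP.m∸n+n≡m (ℕP.m≤n⇒m≤1+n j≤n) ⟩
            suc n         ∎)
          where open ℕP.≤-Reasoning

isRoot? : ∀ {n} → Maybe (Fin n) → Bool
isRoot? m = ⌊ MaybeP.≡-dec Fin._≟_ m nothing ⌋

isRoot?-true : ∀ {n} {m : Maybe (Fin n)} → m ≡ nothing → isRoot? m ≡ true
isRoot?-true {m = m} = ⌊⌋-true (MaybeP.≡-dec Fin._≟_ m nothing)

isRoot?-true⁻¹ : ∀ {n} {m : Maybe (Fin n)} → isRoot? m ≡ true → m ≡ nothing
isRoot?-true⁻¹ {m = m} = ⌊⌋-true⁻¹ (MaybeP.≡-dec Fin._≟_ m nothing)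

isForest?-sound : ∀ {n} (F : ParentMap n) → isForest? F ≡ true → isForest F
isForest?-sound {n} F accepted v = ⌊⌋-true⁻¹ (MaybeP.≡-dec Fin._≟_ (anc F n v) nothing)
  (Equivalence.to T-≡ (AllP.tabulate⁻ (AllP.all⁺ _ (allFin n) (Equivalence.from T-≡ accepted)) v))

isForest?-complete : ∀ {n} (F : ParentMap n) → isForest F → isForest? F ≡ true
isForest?-complete {n} F forest = Equivalence.to T-≡ (AllP.all⁻ _ (AllP.tabulate⁺ λ v →
  Equivalence.from T-≡ (⌊⌋-true (MaybeP.≡-dec Fin._≟_ (anc F n v) nothing) (forest v))))

record RootAfter {n : ℕ} (F : ParentMap n) (u : Fin n) (j : ℕ) (r : Fin n) : Set where
  constructor rootAfter
  field
    anc≡root : anc F j u ≡ just r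
    root-parent : lookup F r ≡ nothing
open RootAfter

module _ {n : ℕ} (F : ParentMap n) where

  anc-nothing⇒root : ∀ u k → anc F k u ≡ nothing → ∃ λ j → ∃ λ r → j < k × RootAfter F u j r
  anc-nothing⇒root u zero ()
  anc-nothing⇒root u (suc k) ended = from (anc F k u) refl
    where
    from : ∀ m → anc F k u ≡ m → ∃ λ j → ∃ λ r → j < suc k × RootAfter F u j r
    from nothing eq with anc-nothing⇒root u k eq
    ... | j , r , j<k , root = j , r , ℕP.m≤n⇒m≤1+n j<k , root
    from (just r) eq = k , r , ℕP.n<1+n k , rootAfter eq (trans (sym (trans (anc-suc F k u) (cong (_>>= lookup F) eq))) ended)

  rootAfter-anc-suc : ∀ {u j r} → RootAfter F u j r → anc F (suc j) u ≡ nothing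
  rootAfter-anc-suc {u} {j} root = trans (anc-suc F j u) (trans (cong (_>>= lookup F) (anc≡root root)) (root-parent root))

  rootAfter-unique-steps : ∀ {u j j′ r r′} → RootAfter F u j r → RootAfter F u j′ r′ → j ≡ j′
  rootAfter-unique-steps {u} {j} {j′} root root′ with ℕP.<-cmp j j′
  ... | tri≈ _ j≡j′ _ = j≡j′
  ... | tri< j<j′ _ _ = ⊥-elim (just≢nothing (trans (sym (anc≡root root′)) (anc-nothing-mono F u j<j′ (rootAfter-anc-suc root))))
  ... | tri> _ _ j′<j = ⊥-elim (just≢nothing (trans (sym (anc≡root root)) (anc-nothing-mono F u j′<j (rootAfter-anc-suc root′))))

  rootAfter-unique : ∀ {u j j′ r r′} → RootAfter F u j r → RootAfter F u j′ r′ → r ≡ r′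
  rootAfter-unique {u} root root′ = MaybeP.just-injective
    (trans (sym (anc≡root root)) (trans (cong (λ ℓ → anc F ℓ u) (rootAfter-unique-steps root root′)) (anc≡root root′)))

  properDesc-true⁻¹ : ∀ a w → properDesc F a w ≡ true → ∃ λ i → i < n × anc F (suc i) w ≡ just a
  properDesc-true⁻¹ a w isDesc with AnyP.applyUpTo⁻ suc (AnyP.any⁻ _ (applyUpTo suc n) (Equivalence.from T-≡ isDesc))
  ... | i , i<n , found = i , i<n , toWitness found

  properDesc-true : ∀ a w i → i < n → anc F (suc i) w ≡ just a → properDesc F a w ≡ true
  properDesc-true a w i i<n found =
    Equivalence.to T-≡ (AnyP.any⁺ _ (AnyP.applyUpTo⁺ suc (fromWitness found) i<n))

  properDesc-of-root : ∀ a r → lookup F r ≡ nothing → properDesc F a r ≡ false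
  properDesc-of-root a r isRoot with properDesc F a r in isDesc
  ... | false = refl
  ... | true with properDesc-true⁻¹ a r isDesc
  ...   | i , _ , found = ⊥-elim (just≢nothing (trans (sym found) (root-anc-suc F r isRoot i)))

module _ {n : ℕ} (F : ParentMap n) (forest : isForest F) where

  rootData : ∀ u → ∃ λ j → ∃ λ r → j < n × RootAfter F u j r
  rootData u = anc-nothing⇒root F u n (forest u)

  rootOf : Fin n → Fin n
  rootOf u = proj₁ (proj₂ (rootData u))

  rootOf-isRoot : ∀ u → lookup F (rootOf u) ≡ nothing
  rootOf-isRoot u = root-parent (proj₂ (proj₂ (proj₂ (rootData u))))

  rootOf-unique : ∀ u {j r} → RootAfter F u j r → rootOf u ≡ r
  rootOf-unique u = rootAfter-unique F (proj₂ (proj₂ (proj₂ (rootData u))))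

  rootOf-root : ∀ r → lookup F r ≡ nothing → rootOf r ≡ r
  rootOf-root r isRoot = rootOf-unique r {0} (rootAfter refl isRoot)

  properDesc-root : ∀ r u → lookup F r ≡ nothing → u ≢ r → properDesc F r u ≡ ⌊ rootOf u Fin.≟ r ⌋
  properDesc-root r u isRoot u≢r = Bool-ext desc⇒root root⇒desc
    where
    desc⇒root : properDesc F r u ≡ true → ⌊ rootOf u Fin.≟ r ⌋ ≡ true
    desc⇒root isDesc with properDesc-true⁻¹ F r u isDesc
    ... | i , _ , found = ⌊⌋-true (rootOf u Fin.≟ r) (rootOf-unique u {suc i} (rootAfter found isRoot))
    root⇒desc : ⌊ rootOf u Fin.≟ r ⌋ ≡ true → properDesc F r u ≡ true
    root⇒desc isRootOf = viaPath (rootData u) (⌊⌋-true⁻¹ (rootOf u Fin.≟ r) isRootOf)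
      where
      viaPath : (d : ∃ λ j → ∃ λ r′ → j < n × RootAfter F u j r′) → proj₁ (proj₂ d) ≡ r → properDesc F r u ≡ true
      viaPath (zero , _ , _ , root) refl = ⊥-elim (u≢r (MaybeP.just-injective (anc≡root root)))
      viaPath (suc i , _ , i<n , root) refl = properDesc-true F _ u i (ℕP.<-trans (ℕP.n<1+n i) i<n) (anc≡root root)

hook-root : ∀ {n} (F : ParentMap n) (forest : isForest F) r → lookup F r ≡ nothing →
  ℕ→ℚ (hook F r) ≡ ∑[ u ∈ allFin n ] 𝟙 ⌊ rootOf F forest u Fin.≟ r ⌋
hook-root {suc n} F forest r isRoot = begin
    ℕ→ℚ (suc (count (properDesc F r)))
  ≡⟨ ℕ→ℚ-suc (count (properDesc F r)) ⟩
    1ℚ + ℕ→ℚ (count (properDesc F r))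
  ≡⟨ cong (λ k → 1ℚ + ℕ→ℚ k) (count-remove r (properDesc F r)) ⟩
    1ℚ + ℕ→ℚ (bit (properDesc F r r) ℕ.+ count (properDesc F r ∘ punchIn r))
  ≡⟨ cong (λ b → 1ℚ + ℕ→ℚ (bit b ℕ.+ count (properDesc F r ∘ punchIn r))) (properDesc-of-root F r r isRoot) ⟩
    1ℚ + ℕ→ℚ (count (properDesc F r ∘ punchIn r))
  ≡⟨ cong (λ k → 1ℚ + ℕ→ℚ k) (count-cong (λ w → properDesc-root F forest r (punchIn r w) isRoot (FinP.punchInᵢ≢i r w))) ⟩
    1ℚ + ℕ→ℚ (count (λ w → sameRoot (punchIn r w)))
  ≡⟨ cong₂ _+_ (cong 𝟙 (sym (⌊⌋-true (rootOf F forest r Fin.≟ r) (rootOf-root F forest r isRoot)))) (ℕ→ℚ-count (sameRoot ∘ punchIn r)) ⟩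
    𝟙 (sameRoot r) + ∑[ w ∈ allFin n ] 𝟙 (sameRoot (punchIn r w))
  ≡⟨ ∑-allFin-remove r (𝟙 ∘ sameRoot) ⟨
    ∑[ u ∈ allFin (suc n) ] 𝟙 (sameRoot u)
  ∎ where
  open ≡-Reasoning
  sameRoot : Fin (suc n) → Bool
  sameRoot u = ⌊ rootOf F forest u Fin.≟ r ⌋

-- Each vertex lies in exactly one tree, so the tree sizes add up to n.
∑-hook-roots : ∀ {n} (F : ParentMap n) → isForest F →
  ∑[ r ∈ allFin n ] (𝟙 (isRoot? (lookup F r)) * ℕ→ℚ (hook F r)) ≡ ℕ→ℚ n
∑-hook-roots {n} F forest = begin
    ∑[ r ∈ allFin n ] (𝟙 (isRoot? (lookup F r)) * ℕ→ℚ (hook F r))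
  ≡⟨ ∑-cong (allFin n) (λ r → 𝟙-* (isRoot? (lookup F r)) _ _ (hook-root F forest r ∘ isRoot?-true⁻¹)) ⟩
    ∑[ r ∈ allFin n ] (𝟙 (isRoot? (lookup F r)) * ∑[ u ∈ allFin n ] 𝟙 (sameRoot u r))
  ≡⟨ ∑-cong (allFin n) (λ r → *-distribˡ-∑ (𝟙 (isRoot? (lookup F r))) (allFin n) (λ u → 𝟙 (sameRoot u r))) ⟩
    ∑[ r ∈ allFin n ] ∑[ u ∈ allFin n ] (𝟙 (isRoot? (lookup F r)) * 𝟙 (sameRoot u r))
  ≡⟨ ∑-comm (allFin n) (allFin n) (λ r u → 𝟙 (isRoot? (lookup F r)) * 𝟙 (sameRoot u r)) ⟩
    ∑[ u ∈ allFin n ] ∑[ r ∈ allFin n ] (𝟙 (isRoot? (lookup F r)) * 𝟙 (sameRoot u r))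
  ≡⟨ ∑-cong (allFin n) (λ u → ∑-allFin-δ (rootOf F forest u) (λ r → 𝟙 (isRoot? (lookup F r)))) ⟩
    ∑[ u ∈ allFin n ] 𝟙 (isRoot? (lookup F (rootOf F forest u)))
  ≡⟨ ∑-cong (allFin n) (λ u → cong 𝟙 (isRoot?-true (rootOf-isRoot F forest u))) ⟩
    ∑[ u ∈ allFin n ] 1ℚ
  ≡⟨ ∑-allFin-const n 1ℚ ⟩
    ℕ→ℚ n * 1ℚ
  ≡⟨ ℚP.*-identityʳ (ℕ→ℚ n) ⟩
    ℕ→ℚ n
  ∎ where
  open ≡-Reasoning
  sameRoot : Fin n → Fin n → Bool
  sameRoot u r = ⌊ rootOf F forest u Fin.≟ r ⌋

-- Adjoining a new root

adjoinEntry : ∀ {n} (v : Fin (suc n)) → Maybe (Fin n) → Bool → Maybe (Fin (suc n))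
adjoinEntry v nothing false = nothing
adjoinEntry v nothing true = just v
adjoinEntry v (just w) _ = just (punchIn v w)

-- M marks the roots of G that become children of the new root v.
adjoinRoot : ∀ {n} (v : Fin (suc n)) → ParentMap n → Vec Bool n → ParentMap (suc n)
adjoinRoot v G M = insertAt (zipWith (adjoinEntry v) G M) v nothing

-- How an ancestor in the enlarged forest corresponds to the ancestor in G.
data Lifted {n : ℕ} (v : Fin (suc n)) : Maybe (Fin (suc n)) → Maybe (Fin n) → Set where
  lifted : ∀ y → Lifted v (just (punchIn v y)) (just y)
  ended : Lifted v nothing nothing
  at-new-root : Lifted v (just v) nothing

lifted-adjoinEntry : ∀ {n} (v : Fin (suc n)) m b → Lifted v (adjoinEntry v m b) m
lifted-adjoinEntry v nothing false = ended
lifted-adjoinEntry v nothing true = at-new-root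
lifted-adjoinEntry v (just w) b = lifted w

module _ {n : ℕ} (v : Fin (suc n)) (G : ParentMap n) (M : Vec Bool n) where
  private
    F = adjoinRoot v G M

  adjoinRoot-new : lookup F v ≡ nothing
  adjoinRoot-new = VecP.insertAt-lookup (zipWith (adjoinEntry v) G M) v nothing

  adjoinRoot-old : ∀ u → lookup F (punchIn v u) ≡ adjoinEntry v (lookup G u) (lookup M u)
  adjoinRoot-old u = trans (VecP.insertAt-punchIn (zipWith (adjoinEntry v) G M) v nothing u)
                           (VecP.lookup-zipWith (adjoinEntry v) u G M)

  lifted-parent : ∀ {a b} → Lifted v a b → Lifted v (a >>= lookup F) (b >>= lookup G)
  lifted-parent (lifted y) = subst (λ a → Lifted v a (lookup G y)) (sym (adjoinRoot-old y)) (lifted-adjoinEntry v (lookup G y) (lookup M y))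
  lifted-parent ended = ended
  lifted-parent at-new-root = subst (λ a → Lifted v a nothing) (sym adjoinRoot-new) ended

  lifted-anc : ∀ k u → Lifted v (anc F k (punchIn v u)) (anc G k u)
  lifted-anc zero u = lifted u
  lifted-anc (suc k) u = subst₂ (Lifted v) (sym (anc-suc F k (punchIn v u))) (sym (anc-suc G k u)) (lifted-parent (lifted-anc k u))

  lifted-nothing : ∀ {b} → Lifted v nothing b → b ≡ nothing
  lifted-nothing ended = refl

  lifted-just : ∀ {a y} → Lifted v a (just y) → a ≡ just (punchIn v y)
  lifted-just (lifted y) = refl

  lifted-punchIn : ∀ {a b y} → Lifted v a b → a ≡ just (punchIn v y) → b ≡ just y
  lifted-punchIn {y = y} (lifted y′) eq = cong just (FinP.punchIn-injective v y′ y (MaybeP.just-injective eq))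
  lifted-punchIn {y = y} at-new-root eq = ⊥-elim (FinP.punchInᵢ≢i v y (sym (MaybeP.just-injective eq)))

  lifted-ended : ∀ {a} → Lifted v a nothing → (a >>= lookup F) ≡ nothing
  lifted-ended ended = refl
  lifted-ended at-new-root = adjoinRoot-new

  adjoinRoot-forest : isForest G → isForest F
  adjoinRoot-forest forest x with v Fin.≟ x
  ... | yes refl = root-anc-suc F v adjoinRoot-new n
  ... | no v≢x rewrite sym (FinP.punchIn-punchOut v≢x) = trans (anc-suc F n _)
          (lifted-ended (subst (Lifted v _) (forest (punchOut v≢x)) (lifted-anc n (punchOut v≢x))))

  adjoinRoot-forest⁻¹ : isForest F → isForest G
  adjoinRoot-forest⁻¹ forest u = anc-depth-bound G u
    (lifted-nothing (subst (λ a → Lifted v a (anc G (suc n) u)) (forest (punchIn v u)) (lifted-anc (suc n) u)))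

  isForest?-adjoinRoot : isForest? F ≡ isForest? G
  isForest?-adjoinRoot = Bool-ext
    (λ accepted → isForest?-complete G (adjoinRoot-forest⁻¹ (isForest?-sound F accepted)))
    (λ accepted → isForest?-complete F (adjoinRoot-forest (isForest?-sound G accepted)))

  properDesc-adjoinRoot-old : isForest G → ∀ u w → properDesc F (punchIn v u) (punchIn v w) ≡ properDesc G u w
  properDesc-adjoinRoot-old forest u w = Bool-ext inF⇒inG inG⇒inF
    where
    inF⇒inG : properDesc F (punchIn v u) (punchIn v w) ≡ true → properDesc G u w ≡ true
    inF⇒inG isDesc with properDesc-true⁻¹ F (punchIn v u) (punchIn v w) isDesc
    ... | i , s≤s i≤n , found = properDesc-true G u w i (ℕP.≤∧≢⇒< i≤n i≢n) foundG
      where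
      foundG : anc G (suc i) w ≡ just u
      foundG = lifted-punchIn (lifted-anc (suc i) w) found
      i≢n : i ≢ n
      i≢n refl = just≢nothing (trans (sym foundG) (anc-nothing-mono G w (ℕP.n≤1+n n) (forest w)))
    inG⇒inF : properDesc G u w ≡ true → properDesc F (punchIn v u) (punchIn v w) ≡ true
    inG⇒inF isDesc with properDesc-true⁻¹ G u w isDesc
    ... | i , i<n , found = properDesc-true F (punchIn v u) (punchIn v w) i (ℕP.m≤n⇒m≤1+n i<n)
            (lifted-just (subst (Lifted v (anc F (suc i) (punchIn v w))) found (lifted-anc (suc i) w)))

  hook-adjoinRoot-old : isForest G → ∀ u → hook F (punchIn v u) ≡ hook G u
  hook-adjoinRoot-old forest u = cong suc (begin
      count (properDesc F (punchIn v u))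
    ≡⟨ count-remove v (properDesc F (punchIn v u)) ⟩
      bit (properDesc F (punchIn v u) v) ℕ.+ count (λ w → properDesc F (punchIn v u) (punchIn v w))
    ≡⟨ cong₂ (λ b k → bit b ℕ.+ k) (properDesc-of-root F (punchIn v u) v adjoinRoot-new) (count-cong (properDesc-adjoinRoot-old forest u)) ⟩
      count (properDesc G u)
    ∎)
    where open ≡-Reasoning

  parent-is-new : ∀ m b → adjoinEntry v m b ≡ just v → m ≡ nothing × b ≡ true
  parent-is-new nothing false ()
  parent-is-new nothing true _ = refl , refl
  parent-is-new (just w) b eq = ⊥-elim (FinP.punchInᵢ≢i v w (MaybeP.just-injective eq))

  lifted-child-of-new : ∀ {a b} → Lifted v a b → (a >>= lookup F) ≡ just v →
    ∃ λ y → b ≡ just y × lookup G y ≡ nothing × lookup M y ≡ true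
  lifted-child-of-new (lifted y) eq with parent-is-new (lookup G y) (lookup M y) (trans (sym (adjoinRoot-old y)) eq)
  ... | isRoot , marked = y , refl , isRoot , marked
  lifted-child-of-new at-new-root eq = ⊥-elim (just≢nothing (trans (sym eq) adjoinRoot-new))

  properDesc-adjoinRoot-new : (forest : isForest G) → ∀ u → properDesc F v (punchIn v u) ≡ lookup M (rootOf G forest u)
  properDesc-adjoinRoot-new forest u = Bool-ext below⇒marked marked⇒below
    where
    below⇒marked : properDesc F v (punchIn v u) ≡ true → lookup M (rootOf G forest u) ≡ true
    below⇒marked isDesc with properDesc-true⁻¹ F v (punchIn v u) isDesc
    ... | i , _ , found with lifted-child-of-new (lifted-anc i u) (trans (sym (anc-suc F i (punchIn v u))) found)
    ...   | y , reaches , isRoot , marked = trans (cong (lookup M) (rootOf-unique G forest u {i} (rootAfter reaches isRoot))) marked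
    marked⇒below : lookup M (rootOf G forest u) ≡ true → properDesc F v (punchIn v u) ≡ true
    marked⇒below = viaPath (rootData G forest u)
      where
      viaPath : (d : ∃ λ j → ∃ λ r → j < n × RootAfter G u j r) → lookup M (proj₁ (proj₂ d)) ≡ true → properDesc F v (punchIn v u) ≡ true
      viaPath (j , r , j<n , rootAfter reaches isRoot) marked = properDesc-true F v (punchIn v u) j (ℕP.m≤n⇒m≤1+n j<n) (begin
          anc F (suc j) (punchIn v u)                   ≡⟨ anc-suc F j (punchIn v u) ⟩
          (anc F j (punchIn v u) >>= lookup F)          ≡⟨ cong (_>>= lookup F) (lifted-just (subst (Lifted v _) reaches (lifted-anc j u))) ⟩
          lookup F (punchIn v r)                        ≡⟨ adjoinRoot-old r ⟩
          adjoinEntry v (lookup G r) (lookup M r)       ≡⟨ cong₂ (adjoinEntry v) isRoot marked ⟩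
          just v                                        ∎)
        where open ≡-Reasoning

  hook-adjoinRoot-new : (forest : isForest G) → hook F v ≡ suc (count (λ u → lookup M (rootOf G forest u)))
  hook-adjoinRoot-new forest = cong suc (begin
      count (properDesc F v)
    ≡⟨ count-remove v (properDesc F v) ⟩
      bit (properDesc F v v) ℕ.+ count (λ w → properDesc F v (punchIn v w))
    ≡⟨ cong₂ (λ b k → bit b ℕ.+ k) (properDesc-of-root F v v adjoinRoot-new) (count-cong (properDesc-adjoinRoot-new forest)) ⟩
      count (λ u → lookup M (rootOf G forest u))
    ∎)
    where open ≡-Reasoning

  isRoot?-adjoinEntry : ∀ m b → isRoot? (adjoinEntry v m b) ≡ isRoot? m ∧ not b
  isRoot?-adjoinEntry nothing false = refl
  isRoot?-adjoinEntry nothing true = refl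
  isRoot?-adjoinEntry (just w) b = refl

  tree-adjoinRoot : tree F ≡ suc (count (λ u → isRoot? (lookup G u) ∧ not (lookup M u)))
  tree-adjoinRoot = begin
      count (λ x → isRoot? (lookup F x))
    ≡⟨ count-remove v (λ x → isRoot? (lookup F x)) ⟩
      bit (isRoot? (lookup F v)) ℕ.+ count (λ u → isRoot? (lookup F (punchIn v u)))
    ≡⟨ cong₂ (λ m k → bit (isRoot? m) ℕ.+ k) adjoinRoot-new
         (count-cong (λ u → trans (cong isRoot? (adjoinRoot-old u)) (isRoot?-adjoinEntry (lookup G u) (lookup M u)))) ⟩
      suc (count (λ u → isRoot? (lookup G u) ∧ not (lookup M u)))
    ∎
    where open ≡-Reasoning

^-+ : (x : ℚ) (a b : ℕ) → x ^ (a ℕ.+ b) ≡ x ^ a * x ^ b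
^-+ x zero b = sym (ℚP.*-identityˡ (x ^ b))
^-+ x (suc a) b = trans (cong (x *_) (^-+ x a b)) (sym (ℚP.*-assoc x (x ^ a) (x ^ b)))

∑-allVecs-suc : (xs : List A) (k : ℕ) (f : Vec A (suc k) → ℚ) →
  ∑ (allVecs xs (suc k)) f ≡ ∑[ x ∈ xs ] ∑[ V ∈ allVecs xs k ] f (x ∷ V)
∑-allVecs-suc xs k f = trans (∑-concatMap (λ x → map (x ∷_) (allVecs xs k)) xs f)
  (∑-cong xs (λ x → ∑-map (x ∷_) (allVecs xs k) f))

∑-allVecs-separable : (xs : List A) (k : ℕ) (f : Vec A (suc k) → ℚ) (φ : A → ℚ) (ψ : Vec A k → ℚ) →
  (∀ x V → f (x ∷ V) ≡ φ x * ψ V) → ∑ (allVecs xs (suc k)) f ≡ ∑ xs φ * ∑ (allVecs xs k) ψ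
∑-allVecs-separable xs k f φ ψ f≡φψ = begin
    ∑ (allVecs xs (suc k)) f
  ≡⟨ ∑-allVecs-suc xs k f ⟩
    ∑[ x ∈ xs ] ∑[ V ∈ allVecs xs k ] f (x ∷ V)
  ≡⟨ ∑-cong xs (λ x → trans (∑-cong (allVecs xs k) (f≡φψ x)) (sym (*-distribˡ-∑ (φ x) (allVecs xs k) ψ))) ⟩
    ∑[ x ∈ xs ] (φ x * ∑ (allVecs xs k) ψ)
  ≡⟨ *-distribʳ-∑ (∑ (allVecs xs k) ψ) xs φ ⟨
    ∑ xs φ * ∑ (allVecs xs k) ψ
  ∎ where open ≡-Reasoning

∑-allVecs-insertAt : (xs : List A) (k : ℕ) (i : Fin (suc k)) (f : Vec A (suc k) → ℚ) →
  ∑ (allVecs xs (suc k)) f ≡ ∑[ x ∈ xs ] ∑[ V ∈ allVecs xs k ] f (insertAt V i x)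
∑-allVecs-insertAt xs k zero f = ∑-allVecs-suc xs k f
∑-allVecs-insertAt xs (suc k) (suc i) f = begin
    ∑ (allVecs xs (suc (suc k))) f
  ≡⟨ ∑-allVecs-suc xs (suc k) f ⟩
    ∑[ y ∈ xs ] ∑[ V ∈ allVecs xs (suc k) ] f (y ∷ V)
  ≡⟨ ∑-cong xs (λ y → ∑-allVecs-insertAt xs k i (λ V → f (y ∷ V))) ⟩
    ∑[ y ∈ xs ] ∑[ x ∈ xs ] ∑[ W ∈ allVecs xs k ] f (y ∷ insertAt W i x)
  ≡⟨ ∑-comm xs xs (λ y x → ∑[ W ∈ allVecs xs k ] f (insertAt (y ∷ W) (suc i) x)) ⟩
    ∑[ x ∈ xs ] ∑[ y ∈ xs ] ∑[ W ∈ allVecs xs k ] f (insertAt (y ∷ W) (suc i) x)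
  ≡⟨ ∑-cong xs (λ x → ∑-allVecs-suc xs k (λ V → f (insertAt V (suc i) x))) ⟨
    ∑[ x ∈ xs ] ∑[ V ∈ allVecs xs (suc k) ] f (insertAt V (suc i) x)
  ∎ where open ≡-Reasoning

zipProd : {k : ℕ} → (A → B → ℚ) → Vec A k → Vec B k → ℚ
zipProd w [] [] = 1ℚ
zipProd w (a ∷ as) (b ∷ bs) = w a b * zipProd w as bs

∑-allVecs-reparametrise : (xs : List A) (ys : List B) (zs : List C)
  (e : B → C → A) (w : B → C → ℚ) →
  (∀ (g : A → ℚ) → ∑ xs g ≡ ∑[ y ∈ ys ] ∑[ z ∈ zs ] (w y z * g (e y z))) →
  (k : ℕ) (f : Vec A k → ℚ) →
  ∑ (allVecs xs k) f ≡ ∑[ G ∈ allVecs ys k ] ∑[ M ∈ allVecs zs k ] (zipProd w G M * f (zipWith e G M))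
∑-allVecs-reparametrise xs ys zs e w coord zero f =
  solve 1 (λ a → a :+ con 0ℚ := (con 1ℚ :* a :+ con 0ℚ) :+ con 0ℚ) refl (f [])
∑-allVecs-reparametrise {A = A} {B = B} {C = C} xs ys zs e w coord (suc k) f = begin
    ∑ (allVecs xs (suc k)) f
  ≡⟨ ∑-allVecs-suc xs k f ⟩
    ∑[ x ∈ xs ] ∑[ V ∈ allVecs xs k ] f (x ∷ V)
  ≡⟨ ∑-cong xs (λ x → ∑-allVecs-reparametrise xs ys zs e w coord k (λ V → f (x ∷ V))) ⟩
    ∑[ x ∈ xs ] rest x
  ≡⟨ coord rest ⟩
    ∑[ y ∈ ys ] ∑[ z ∈ zs ] (w y z * rest (e y z))
  ≡⟨ ∑-cong ys (λ y → ∑-cong zs (λ z → pull-in y z)) ⟩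
    ∑[ y ∈ ys ] ∑[ z ∈ zs ] ∑[ G ∈ allVecs ys k ] ∑[ M ∈ allVecs zs k ] term (y ∷ G) (z ∷ M)
  ≡⟨ ∑-cong ys (λ y → ∑-comm zs (allVecs ys k) (λ z G → ∑[ M ∈ allVecs zs k ] term (y ∷ G) (z ∷ M))) ⟩
    ∑[ y ∈ ys ] ∑[ G ∈ allVecs ys k ] ∑[ z ∈ zs ] ∑[ M ∈ allVecs zs k ] term (y ∷ G) (z ∷ M)
  ≡⟨ ∑-cong ys (λ y → ∑-cong (allVecs ys k) (λ G → ∑-allVecs-suc zs k (term (y ∷ G)))) ⟨
    ∑[ y ∈ ys ] ∑[ G ∈ allVecs ys k ] ∑ (allVecs zs (suc k)) (term (y ∷ G))
  ≡⟨ ∑-allVecs-suc ys k (λ G → ∑ (allVecs zs (suc k)) (term G)) ⟨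
    ∑[ G ∈ allVecs ys (suc k) ] ∑[ M ∈ allVecs zs (suc k) ] term G M
  ∎ where
  open ≡-Reasoning
  rest : A → ℚ
  rest x = ∑[ G ∈ allVecs ys k ] ∑[ M ∈ allVecs zs k ] (zipProd w G M * f (x ∷ zipWith e G M))
  term : Vec B (suc k) → Vec C (suc k) → ℚ
  term G M = zipProd w G M * f (zipWith e G M)
  pull-in : ∀ y z → w y z * rest (e y z) ≡ ∑[ G ∈ allVecs ys k ] ∑[ M ∈ allVecs zs k ] term (y ∷ G) (z ∷ M)
  pull-in y z = trans (*-distribˡ-∑ (w y z) (allVecs ys k) _) (∑-cong (allVecs ys k) λ G →
    trans (*-distribˡ-∑ (w y z) (allVecs zs k) _) (∑-cong (allVecs zs k) λ M →
      sym (ℚP.*-assoc (w y z) (zipProd w G M) (f (e y z ∷ zipWith e G M)))))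

bools : List Bool
bools = false ∷ true ∷ []

-- Only a root may be marked.
markWeight : ∀ {m} → Maybe (Fin m) → Bool → ℚ
markWeight nothing _ = 1ℚ
markWeight (just _) false = 1ℚ
markWeight (just _) true = 0ℚ

∑-allMaybeFin-adjoinEntry : ∀ n (v : Fin (suc n)) (g : Maybe (Fin (suc n)) → ℚ) →
  ∑ (allMaybeFin (suc n)) g ≡ ∑[ y ∈ allMaybeFin n ] ∑[ b ∈ bools ] (markWeight y b * g (adjoinEntry v y b))
∑-allMaybeFin-adjoinEntry n v g = begin
    g nothing + ∑ (map just (allFin (suc n))) g
  ≡⟨ cong (g nothing +_) (trans (∑-map just (allFin (suc n)) g) (∑-allFin-remove v (g ∘ just))) ⟩
    g nothing + (g (just v) + ∑[ u ∈ allFin n ] g (just (punchIn v u)))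
  ≡⟨ solve 3 (λ a b s → a :+ (b :+ s) := (con 1ℚ :* a :+ (con 1ℚ :* b :+ con 0ℚ)) :+ s) refl (g nothing) (g (just v)) _ ⟩
    (1ℚ * g nothing + (1ℚ * g (just v) + 0ℚ)) + ∑[ u ∈ allFin n ] g (just (punchIn v u))
  ≡⟨ cong (entries-v +_) (∑-cong (allFin n) (λ u → solve 1 (λ a → a := con 1ℚ :* a :+ (con 0ℚ :* a :+ con 0ℚ)) refl (g (just (punchIn v u))))) ⟩
    (1ℚ * g nothing + (1ℚ * g (just v) + 0ℚ)) + ∑[ u ∈ allFin n ] ∑[ b ∈ bools ] (markWeight (just u) b * g (adjoinEntry v (just u) b))
  ≡⟨ cong (entries-v +_) (∑-map just (allFin n) (λ y → ∑[ b ∈ bools ] (markWeight y b * g (adjoinEntry v y b)))) ⟨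
    ∑[ y ∈ allMaybeFin n ] ∑[ b ∈ bools ] (markWeight y b * g (adjoinEntry v y b))
  ∎ where
  open ≡-Reasoning
  entries-v = 1ℚ * g nothing + (1ℚ * g (just v) + 0ℚ)

rootAt? : ∀ {m n} → Vec (Maybe (Fin m)) n → Fin n → Bool
rootAt? G u = isRoot? (lookup G u)

unmarkedRootAt? : ∀ {m n} → Vec (Maybe (Fin m)) n → Vec Bool n → Fin n → Bool
unmarkedRootAt? G M u = isRoot? (lookup G u) ∧ not (lookup M u)

module _ {m : ℕ} (y : ℚ) where

  ^-count-unmarked-∷ : ∀ {n} g (G : Vec (Maybe (Fin m)) n) b M →
    y ^ count (unmarkedRootAt? (g ∷ G) (b ∷ M)) ≡ y ^ bit (isRoot? g ∧ not b) * y ^ count (unmarkedRootAt? G M)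
  ^-count-unmarked-∷ g G b M = trans (cong (y ^_) (count-remove zero (unmarkedRootAt? (g ∷ G) (b ∷ M)))) (^-+ y (bit (isRoot? g ∧ not b)) (count (unmarkedRootAt? G M)))

  ∑-mark-entry : (g : Maybe (Fin m)) → ∑[ b ∈ bools ] (markWeight g b * y ^ bit (isRoot? g ∧ not b)) ≡ (1ℚ + y) ^ bit (isRoot? g)
  ∑-mark-entry nothing = solve 1 (λ y → con 1ℚ :* (y :* con 1ℚ) :+ (con 1ℚ :* con 1ℚ :+ con 0ℚ) := (con 1ℚ :+ y) :* con 1ℚ) refl y
  ∑-mark-entry (just _) = refl

  -- Each root is either marked or contributes a factor y.
  ∑-marks : ∀ {n} (G : Vec (Maybe (Fin m)) n) →
    ∑[ M ∈ allVecs bools n ] (zipProd markWeight G M * y ^ count (unmarkedRootAt? G M)) ≡ (1ℚ + y) ^ count (rootAt? G)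
  ∑-marks [] = solve 1 (λ y → con 1ℚ :* con 1ℚ :+ con 0ℚ := con 1ℚ) refl y
  ∑-marks {suc n} (g ∷ G) = begin
      ∑[ M ∈ allVecs bools (suc n) ] (zipProd markWeight (g ∷ G) M * y ^ count (unmarkedRootAt? (g ∷ G) M))
    ≡⟨ ∑-allVecs-separable bools n _ (λ b → markWeight g b * y ^ bit (isRoot? g ∧ not b))
         (λ M → zipProd markWeight G M * y ^ count (unmarkedRootAt? G M)) factor ⟩
      ∑[ b ∈ bools ] (markWeight g b * y ^ bit (isRoot? g ∧ not b)) * ∑[ M ∈ allVecs bools n ] (zipProd markWeight G M * y ^ count (unmarkedRootAt? G M))
    ≡⟨ cong₂ _*_ (∑-mark-entry g) (∑-marks G) ⟩
      (1ℚ + y) ^ bit (isRoot? g) * (1ℚ + y) ^ count (rootAt? G)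
    ≡⟨ trans (cong ((1ℚ + y) ^_) (count-remove zero (rootAt? (g ∷ G)))) (^-+ (1ℚ + y) (bit (isRoot? g)) (count (rootAt? G))) ⟨
      (1ℚ + y) ^ count (rootAt? (g ∷ G))
    ∎ where
    open ≡-Reasoning
    factor : ∀ b M → zipProd markWeight (g ∷ G) (b ∷ M) * y ^ count (unmarkedRootAt? (g ∷ G) (b ∷ M))
                   ≡ (markWeight g b * y ^ bit (isRoot? g ∧ not b)) * (zipProd markWeight G M * y ^ count (unmarkedRootAt? G M))
    factor b M = trans (cong (zipProd markWeight (g ∷ G) (b ∷ M) *_) (^-count-unmarked-∷ g G b M))
      (solve 4 (λ a w c d → (a :* w) :* (c :* d) := (a :* c) :* (w :* d)) refl (markWeight g b) (zipProd markWeight G M) _ _)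

  -- With the root j forced to be marked, its factor 1 + y becomes 1.
  ∑-marks-marked : ∀ {n} (G : Vec (Maybe (Fin m)) n) (j : Fin n) → lookup G j ≡ nothing →
    ∑[ M ∈ allVecs bools n ] (zipProd markWeight G M * (𝟙 (lookup M j) * y ^ count (unmarkedRootAt? G M)))
      ≡ (1ℚ + y) ^ (count (rootAt? G) ∸ 1)
  ∑-marks-marked {suc n} (g ∷ G) zero refl = begin
      ∑[ M ∈ allVecs bools (suc n) ] (zipProd markWeight (g ∷ G) M * (𝟙 (lookup M zero) * y ^ count (unmarkedRootAt? (g ∷ G) M)))
    ≡⟨ ∑-allVecs-separable bools n _ (λ b → markWeight g b * (𝟙 b * y ^ bit (not b)))
         (λ M → zipProd markWeight G M * y ^ count (unmarkedRootAt? G M)) factor ⟩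
      ∑[ b ∈ bools ] (markWeight g b * (𝟙 b * y ^ bit (not b))) * ∑[ M ∈ allVecs bools n ] (zipProd markWeight G M * y ^ count (unmarkedRootAt? G M))
    ≡⟨ cong₂ _*_ (solve 1 (λ y → con 1ℚ :* (con 0ℚ :* (y :* con 1ℚ)) :+ (con 1ℚ :* (con 1ℚ :* con 1ℚ) :+ con 0ℚ) := con 1ℚ) refl y) (∑-marks G) ⟩
      1ℚ * (1ℚ + y) ^ count (rootAt? G)
    ≡⟨ trans (cong (λ k → (1ℚ + y) ^ (k ∸ 1)) (count-remove zero (rootAt? (g ∷ G)))) (sym (ℚP.*-identityˡ _)) ⟨
      (1ℚ + y) ^ (count (rootAt? (g ∷ G)) ∸ 1)
    ∎ where
    open ≡-Reasoning
    factor : ∀ b M → zipProd markWeight (g ∷ G) (b ∷ M) * (𝟙 b * y ^ count (unmarkedRootAt? (g ∷ G) (b ∷ M)))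
                   ≡ (markWeight g b * (𝟙 b * y ^ bit (not b))) * (zipProd markWeight G M * y ^ count (unmarkedRootAt? G M))
    factor b M = trans (cong (λ z → zipProd markWeight (g ∷ G) (b ∷ M) * (𝟙 b * z)) (^-count-unmarked-∷ g G b M))
      (solve 5 (λ a w i c d → (a :* w) :* (i :* (c :* d)) := (a :* (i :* c)) :* (w :* d)) refl (markWeight g b) (zipProd markWeight G M) (𝟙 b) _ _)
  ∑-marks-marked {suc n} (g ∷ G) (suc j) jRoot with count-pos (rootAt? G) j (isRoot?-true jRoot)
  ... | k , count≡1+k = begin
      ∑[ M ∈ allVecs bools (suc n) ] (zipProd markWeight (g ∷ G) M * (𝟙 (lookup M (suc j)) * y ^ count (unmarkedRootAt? (g ∷ G) M)))
    ≡⟨ ∑-allVecs-separable bools n _ (λ b → markWeight g b * y ^ bit (isRoot? g ∧ not b))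
         (λ M → zipProd markWeight G M * (𝟙 (lookup M j) * y ^ count (unmarkedRootAt? G M))) factor ⟩
      ∑[ b ∈ bools ] (markWeight g b * y ^ bit (isRoot? g ∧ not b)) * ∑[ M ∈ allVecs bools n ] (zipProd markWeight G M * (𝟙 (lookup M j) * y ^ count (unmarkedRootAt? G M)))
    ≡⟨ cong₂ _*_ (∑-mark-entry g) (∑-marks-marked G j jRoot) ⟩
      (1ℚ + y) ^ bit (isRoot? g) * (1ℚ + y) ^ (count (rootAt? G) ∸ 1)
    ≡⟨ ^-+ (1ℚ + y) (bit (isRoot? g)) _ ⟨
      (1ℚ + y) ^ (bit (isRoot? g) ℕ.+ (count (rootAt? G) ∸ 1))
    ≡⟨ cong (λ c → (1ℚ + y) ^ (bit (isRoot? g) ℕ.+ (c ∸ 1))) count≡1+k ⟩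
      (1ℚ + y) ^ (bit (isRoot? g) ℕ.+ k)
    ≡⟨ cong (λ c → (1ℚ + y) ^ (c ∸ 1)) (trans (cong (bit (isRoot? g) ℕ.+_) count≡1+k) (ℕP.+-suc _ k)) ⟨
      (1ℚ + y) ^ ((bit (isRoot? g) ℕ.+ count (rootAt? G)) ∸ 1)
    ≡⟨ cong (λ c → (1ℚ + y) ^ (c ∸ 1)) (count-remove zero (rootAt? (g ∷ G))) ⟨
      (1ℚ + y) ^ (count (rootAt? (g ∷ G)) ∸ 1)
    ∎ where
    open ≡-Reasoning
    factor : ∀ b M → zipProd markWeight (g ∷ G) (b ∷ M) * (𝟙 (lookup M j) * y ^ count (unmarkedRootAt? (g ∷ G) (b ∷ M)))
                   ≡ (markWeight g b * y ^ bit (isRoot? g ∧ not b)) * (zipProd markWeight G M * (𝟙 (lookup M j) * y ^ count (unmarkedRootAt? G M)))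
    factor b M = trans (cong (λ z → zipProd markWeight (g ∷ G) (b ∷ M) * (𝟙 (lookup M j) * z)) (^-count-unmarked-∷ g G b M))
      (solve 5 (λ a w i c d → (a :* w) :* (i :* (c :* d)) := (a :* c) :* (w :* (i :* d))) refl (markWeight g b) (zipProd markWeight G M) (𝟙 (lookup M j)) _ _)

-- The recursion for the weighted forest sum

rootWeight : ℚ → ℚ → ℕ → ℚ
rootWeight d y zero = 1ℚ
rootWeight d y (suc k) = d * y ^ k

hookFactor : ∀ {n} → ℚ → ParentMap n → Fin n → ℚ
hookFactor α F x = 1ℚ + α * ((ℤ.+ 1) / hook F x)

hookWeight : ∀ {n} → ℚ → ParentMap n → ℚ
hookWeight {n} α F = ∏[ x ∈ allFin n ] hookFactor α F x

weight : ∀ {n} → ℚ → ℚ → ℚ → ParentMap n → ℚ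
weight α d y F = rootWeight d y (tree F) * hookWeight α F

forestSum : ℕ → ℚ → ℚ → ℚ → ℚ
forestSum n α d y = ∑ (forests n) (weight α d y)

hook-*-hookFactor : ∀ {n} α (F : ParentMap n) x → ℕ→ℚ (hook F x) * hookFactor α F x ≡ ℕ→ℚ (hook F x) + α
hook-*-hookFactor α F x = begin
    h * (1ℚ + α * h⁻¹)     ≡⟨ solve 3 (λ h α h⁻¹ → h :* (con 1ℚ :+ α :* h⁻¹) := h :+ α :* (h :* h⁻¹)) refl h α h⁻¹ ⟩
    h + α * (h * h⁻¹)      ≡⟨ cong (λ z → h + α * z) (ℕ→ℚ-suc-*-inverse (count (properDesc F x))) ⟩
    h + α * 1ℚ             ≡⟨ cong (h +_) (ℚP.*-identityʳ α) ⟩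
    h + α                  ∎
  where
  open ≡-Reasoning
  h = ℕ→ℚ (hook F x)
  h⁻¹ = (ℤ.+ 1) / hook F x

rootedWeight : ∀ {n} → ℚ → ℚ → ℚ → Fin n → ParentMap n → ℚ
rootedWeight α d y v F = 𝟙 (isForest? F) * ((𝟙 (isRoot? (lookup F v)) * ℕ→ℚ (hook F v)) * weight α d y F)

∑-rootedWeight : ∀ n α d y →
  ℕ→ℚ n * forestSum n α d y ≡ ∑[ v ∈ allFin n ] ∑ (allVecs (allMaybeFin n) n) (rootedWeight α d y v)
∑-rootedWeight n α d y = begin
    ℕ→ℚ n * forestSum n α d y
  ≡⟨ cong (ℕ→ℚ n *_) (∑-filter isForest? Fs (weight α d y)) ⟩
    ℕ→ℚ n * ∑[ F ∈ Fs ] (𝟙 (isForest? F) * weight α d y F)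
  ≡⟨ *-distribˡ-∑ (ℕ→ℚ n) Fs _ ⟩
    ∑[ F ∈ Fs ] (ℕ→ℚ n * (𝟙 (isForest? F) * weight α d y F))
  ≡⟨ ∑-cong Fs double-count ⟩
    ∑[ F ∈ Fs ] ∑[ v ∈ allFin n ] rootedWeight α d y v F
  ≡⟨ ∑-comm Fs (allFin n) (λ F v → rootedWeight α d y v F) ⟩
    ∑[ v ∈ allFin n ] ∑[ F ∈ Fs ] rootedWeight α d y v F
  ∎ where
  open ≡-Reasoning
  Fs = allVecs (allMaybeFin n) n
  rootHooks : ParentMap n → ℚ
  rootHooks F = ∑[ v ∈ allFin n ] (𝟙 (isRoot? (lookup F v)) * ℕ→ℚ (hook F v))
  double-count : ∀ F → ℕ→ℚ n * (𝟙 (isForest? F) * weight α d y F) ≡ ∑[ v ∈ allFin n ] rootedWeight α d y v F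
  double-count F = begin
      ℕ→ℚ n * (𝟙 (isForest? F) * weight α d y F)
    ≡⟨ solve 3 (λ a i p → a :* (i :* p) := i :* (a :* p)) refl (ℕ→ℚ n) (𝟙 (isForest? F)) (weight α d y F) ⟩
      𝟙 (isForest? F) * (ℕ→ℚ n * weight α d y F)
    ≡⟨ 𝟙-* (isForest? F) _ _ (λ accepted → cong (_* weight α d y F) (sym (∑-hook-roots F (isForest?-sound F accepted)))) ⟩
      𝟙 (isForest? F) * (rootHooks F * weight α d y F)
    ≡⟨ cong (𝟙 (isForest? F) *_) (*-distribʳ-∑ (weight α d y F) (allFin n) _) ⟩
      𝟙 (isForest? F) * ∑[ v ∈ allFin n ] ((𝟙 (isRoot? (lookup F v)) * ℕ→ℚ (hook F v)) * weight α d y F)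
    ≡⟨ *-distribˡ-∑ (𝟙 (isForest? F)) (allFin n) _ ⟩
      ∑[ v ∈ allFin n ] rootedWeight α d y v F
    ∎

adjoinedWeight : (n : ℕ) → ℚ → ℚ → ℚ → ParentMap n → ℚ
adjoinedWeight n α d y G = d * (hookWeight α G * ((1ℚ + α) * (1ℚ + y) ^ tree G + ℕ→ℚ n * (1ℚ + y) ^ (tree G ∸ 1)))

module _ (n : ℕ) (α d y : ℚ) (v : Fin (suc n)) (G : ParentMap n) (forest : isForest G) where

  markedBelow : Vec Bool n → ℚ
  markedBelow M = ∑[ u ∈ allFin n ] 𝟙 (lookup M (rootOf G forest u))

  unmarkedWeight : Vec Bool n → ℚ
  unmarkedWeight M = y ^ count (unmarkedRootAt? G M)

  rootedWeight-adjoinRoot : ∀ M → rootedWeight α d y v (adjoinRoot v G M)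
    ≡ ((1ℚ + α) + markedBelow M) * ((d * unmarkedWeight M) * hookWeight α G)
  rootedWeight-adjoinRoot M = begin
      rootedWeight α d y v F
    ≡⟨ cong₂ (λ i j → 𝟙 i * ((𝟙 j * ℕ→ℚ (hook F v)) * (rootWeight d y (tree F) * hookWeight α F)))
         (trans (isForest?-adjoinRoot v G M) (isForest?-complete G forest)) (cong isRoot? (adjoinRoot-new v G M)) ⟩
      1ℚ * ((1ℚ * ℕ→ℚ (hook F v)) * (rootWeight d y (tree F) * hookWeight α F))
    ≡⟨ cong (λ z → 1ℚ * ((1ℚ * ℕ→ℚ (hook F v)) * (rootWeight d y (tree F) * z))) (∏-allFin-remove v (hookFactor α F)) ⟩
      1ℚ * ((1ℚ * ℕ→ℚ (hook F v)) * (rootWeight d y (tree F) * (hookFactor α F v * ∏[ u ∈ allFin n ] hookFactor α F (punchIn v u))))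
    ≡⟨ solve 4 (λ h w p q → con 1ℚ :* ((con 1ℚ :* h) :* (p :* (w :* q))) := (h :* w) :* (p :* q)) refl
         (ℕ→ℚ (hook F v)) (hookFactor α F v) (rootWeight d y (tree F)) (∏[ u ∈ allFin n ] hookFactor α F (punchIn v u)) ⟩
      (ℕ→ℚ (hook F v) * hookFactor α F v) * (rootWeight d y (tree F) * ∏[ u ∈ allFin n ] hookFactor α F (punchIn v u))
    ≡⟨ cong₂ _*_ (hook-*-hookFactor α F v) (cong₂ _*_ (cong (rootWeight d y) (tree-adjoinRoot v G M))
         (∏-cong (allFin n) (λ u → cong (λ h → 1ℚ + α * ((ℤ.+ 1) / suc h)) (ℕP.suc-injective (hook-adjoinRoot-old v G M forest u))))) ⟩
      (ℕ→ℚ (hook F v) + α) * ((d * unmarkedWeight M) * hookWeight α G)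
    ≡⟨ cong (λ h → (h + α) * ((d * unmarkedWeight M) * hookWeight α G)) hook-new ⟩
      ((1ℚ + markedBelow M) + α) * ((d * unmarkedWeight M) * hookWeight α G)
    ≡⟨ cong (_* ((d * unmarkedWeight M) * hookWeight α G)) (solve 2 (λ s a → (con 1ℚ :+ s) :+ a := (con 1ℚ :+ a) :+ s) refl (markedBelow M) α) ⟩
      ((1ℚ + α) + markedBelow M) * ((d * unmarkedWeight M) * hookWeight α G)
    ∎ where
    open ≡-Reasoning
    F = adjoinRoot v G M
    hook-new : ℕ→ℚ (hook F v) ≡ 1ℚ + markedBelow M
    hook-new = begin
        ℕ→ℚ (hook F v)                                          ≡⟨ cong ℕ→ℚ (hook-adjoinRoot-new v G M forest) ⟩
        ℕ→ℚ (suc (count (λ u → lookup M (rootOf G forest u))))  ≡⟨ ℕ→ℚ-suc (count (λ u → lookup M (rootOf G forest u))) ⟩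
        1ℚ + ℕ→ℚ (count (λ u → lookup M (rootOf G forest u)))   ≡⟨ cong (1ℚ +_) (ℕ→ℚ-count (λ u → lookup M (rootOf G forest u))) ⟩
        1ℚ + markedBelow M                                      ∎

  ∑-marks-markedBelow : ∑[ M ∈ allVecs bools n ] (zipProd markWeight G M * (markedBelow M * unmarkedWeight M))
    ≡ ℕ→ℚ n * (1ℚ + y) ^ (tree G ∸ 1)
  ∑-marks-markedBelow = begin
      ∑[ M ∈ Ms ] (zipProd markWeight G M * (markedBelow M * unmarkedWeight M))
    ≡⟨ ∑-cong Ms (λ M → trans (cong (zipProd markWeight G M *_) (*-distribʳ-∑ (unmarkedWeight M) (allFin n) _))
                              (*-distribˡ-∑ (zipProd markWeight G M) (allFin n) _)) ⟩
      ∑[ M ∈ Ms ] ∑[ u ∈ allFin n ] (zipProd markWeight G M * (𝟙 (lookup M (rootOf G forest u)) * unmarkedWeight M))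
    ≡⟨ ∑-comm Ms (allFin n) _ ⟩
      ∑[ u ∈ allFin n ] ∑[ M ∈ Ms ] (zipProd markWeight G M * (𝟙 (lookup M (rootOf G forest u)) * unmarkedWeight M))
    ≡⟨ ∑-cong (allFin n) (λ u → ∑-marks-marked y G (rootOf G forest u) (rootOf-isRoot G forest u)) ⟩
      ∑[ u ∈ allFin n ] ((1ℚ + y) ^ (tree G ∸ 1))
    ≡⟨ ∑-allFin-const n _ ⟩
      ℕ→ℚ n * (1ℚ + y) ^ (tree G ∸ 1)
    ∎ where
    open ≡-Reasoning
    Ms = allVecs bools n

  ∑-marks-adjoinRoot : ∑[ M ∈ allVecs bools n ] (zipProd markWeight G M * rootedWeight α d y v (adjoinRoot v G M))
    ≡ adjoinedWeight n α d y G
  ∑-marks-adjoinRoot = begin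
      ∑[ M ∈ Ms ] (zipProd markWeight G M * rootedWeight α d y v (adjoinRoot v G M))
    ≡⟨ ∑-cong Ms (λ M → cong (zipProd markWeight G M *_) (rootedWeight-adjoinRoot M)) ⟩
      ∑[ M ∈ Ms ] (zipProd markWeight G M * ((b + markedBelow M) * ((d * unmarkedWeight M) * W)))
    ≡⟨ ∑-cong Ms (λ M → solve 6 (λ w b s d u wg → w :* ((b :+ s) :* ((d :* u) :* wg)) := (d :* wg) :* (b :* (w :* u) :+ w :* (s :* u))) refl
         (zipProd markWeight G M) b (markedBelow M) d (unmarkedWeight M) W) ⟩
      ∑[ M ∈ Ms ] ((d * W) * (b * (zipProd markWeight G M * unmarkedWeight M) + zipProd markWeight G M * (markedBelow M * unmarkedWeight M)))
    ≡⟨ *-distribˡ-∑ (d * W) Ms _ ⟨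
      (d * W) * ∑[ M ∈ Ms ] (b * (zipProd markWeight G M * unmarkedWeight M) + zipProd markWeight G M * (markedBelow M * unmarkedWeight M))
    ≡⟨ cong ((d * W) *_) (∑-distrib-+ Ms _ _) ⟩
      (d * W) * (∑[ M ∈ Ms ] (b * (zipProd markWeight G M * unmarkedWeight M)) + ∑[ M ∈ Ms ] (zipProd markWeight G M * (markedBelow M * unmarkedWeight M)))
    ≡⟨ cong (λ s → (d * W) * (s + ∑[ M ∈ Ms ] (zipProd markWeight G M * (markedBelow M * unmarkedWeight M)))) (*-distribˡ-∑ b Ms _) ⟨
      (d * W) * (b * ∑[ M ∈ Ms ] (zipProd markWeight G M * unmarkedWeight M) + ∑[ M ∈ Ms ] (zipProd markWeight G M * (markedBelow M * unmarkedWeight M)))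
    ≡⟨ cong₂ (λ s t → (d * W) * (b * s + t)) (∑-marks y G) ∑-marks-markedBelow ⟩
      (d * W) * (b * (1ℚ + y) ^ tree G + ℕ→ℚ n * (1ℚ + y) ^ (tree G ∸ 1))
    ≡⟨ ℚP.*-assoc d W _ ⟩
      adjoinedWeight n α d y G
    ∎ where
    open ≡-Reasoning
    Ms = allVecs bools n
    b = 1ℚ + α
    W = hookWeight α G

∑-marks-rootedWeight : ∀ n α d y (v : Fin (suc n)) (G : ParentMap n) →
  ∑[ M ∈ allVecs bools n ] (zipProd markWeight G M * rootedWeight α d y v (adjoinRoot v G M))
    ≡ 𝟙 (isForest? G) * adjoinedWeight n α d y G
∑-marks-rootedWeight n α d y v G = byCases (isForest? G) refl
  where
  byCases : ∀ b → isForest? G ≡ b →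
    ∑[ M ∈ allVecs bools n ] (zipProd markWeight G M * rootedWeight α d y v (adjoinRoot v G M)) ≡ 𝟙 b * adjoinedWeight n α d y G
  byCases true accepted = trans (∑-marks-adjoinRoot n α d y v G (isForest?-sound G accepted)) (sym (ℚP.*-identityˡ (adjoinedWeight n α d y G)))
  byCases false rejected = trans (∑-zero (allVecs bools n) vanishes) (sym (ℚP.*-zeroˡ (adjoinedWeight n α d y G)))
    where
    vanishes : ∀ M → zipProd markWeight G M * rootedWeight α d y v (adjoinRoot v G M) ≡ 0ℚ
    vanishes M = begin
        zipProd markWeight G M * (𝟙 (isForest? F) * rest)   ≡⟨ cong (λ b → zipProd markWeight G M * (𝟙 b * rest)) (trans (isForest?-adjoinRoot v G M) rejected) ⟩
        zipProd markWeight G M * (0ℚ * rest)                ≡⟨ cong (zipProd markWeight G M *_) (ℚP.*-zeroˡ rest) ⟩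
        zipProd markWeight G M * 0ℚ                         ≡⟨ ℚP.*-zeroʳ (zipProd markWeight G M) ⟩
        0ℚ                                                  ∎
      where
      open ≡-Reasoning
      F = adjoinRoot v G M
      rest = (𝟙 (isRoot? (lookup F v)) * ℕ→ℚ (hook F v)) * weight α d y F

rootedWeight-nonRoot : ∀ {n} α d y (v : Fin n) F {w} → lookup F v ≡ just w → rootedWeight α d y v F ≡ 0ℚ
rootedWeight-nonRoot α d y v F hasParent = begin
    𝟙 (isForest? F) * ((𝟙 (isRoot? (lookup F v)) * ℕ→ℚ (hook F v)) * weight α d y F)
  ≡⟨ cong (λ p → 𝟙 (isForest? F) * ((𝟙 (isRoot? p) * ℕ→ℚ (hook F v)) * weight α d y F)) hasParent ⟩
    𝟙 (isForest? F) * ((0ℚ * ℕ→ℚ (hook F v)) * weight α d y F)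
  ≡⟨ solve 3 (λ i h p → i :* ((con 0ℚ :* h) :* p) := con 0ℚ) refl (𝟙 (isForest? F)) (ℕ→ℚ (hook F v)) (weight α d y F) ⟩
    0ℚ
  ∎ where open ≡-Reasoning

∑-rootedWeight-at : ∀ n α d y (v : Fin (suc n)) →
  ∑ (allVecs (allMaybeFin (suc n)) (suc n)) (rootedWeight α d y v) ≡ ∑ (forests n) (adjoinedWeight n α d y)
∑-rootedWeight-at n α d y v = begin
    ∑ (allVecs entries (suc n)) (rootedWeight α d y v)
  ≡⟨ ∑-allVecs-insertAt entries n v (rootedWeight α d y v) ⟩
    ∑[ x ∈ entries ] ∑[ V ∈ allVecs entries n ] rootedWeight α d y v (insertAt V v x)
  ≡⟨ cong (withRoot +_) (trans (∑-map just (allFin (suc n)) withParent) (∑-zero (allFin (suc n)) v-not-root)) ⟩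
    withRoot + 0ℚ
  ≡⟨ ℚP.+-identityʳ withRoot ⟩
    withRoot
  ≡⟨ ∑-allVecs-reparametrise entries (allMaybeFin n) bools (adjoinEntry v) markWeight (∑-allMaybeFin-adjoinEntry n v) n
       (λ V → rootedWeight α d y v (insertAt V v nothing)) ⟩
    ∑[ G ∈ allVecs (allMaybeFin n) n ] ∑[ M ∈ allVecs bools n ] (zipProd markWeight G M * rootedWeight α d y v (adjoinRoot v G M))
  ≡⟨ ∑-cong (allVecs (allMaybeFin n) n) (∑-marks-rootedWeight n α d y v) ⟩
    ∑[ G ∈ allVecs (allMaybeFin n) n ] (𝟙 (isForest? G) * adjoinedWeight n α d y G)
  ≡⟨ ∑-filter isForest? (allVecs (allMaybeFin n) n) (adjoinedWeight n α d y) ⟨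
    ∑ (forests n) (adjoinedWeight n α d y)
  ∎ where
  open ≡-Reasoning
  entries = allMaybeFin (suc n)
  withRoot = ∑[ V ∈ allVecs entries n ] rootedWeight α d y v (insertAt V v nothing)
  withParent : Maybe (Fin (suc n)) → ℚ
  withParent x = ∑[ V ∈ allVecs entries n ] rootedWeight α d y v (insertAt V v x)
  v-not-root : ∀ w → ∑[ V ∈ allVecs entries n ] rootedWeight α d y v (insertAt V v (just w)) ≡ 0ℚ
  v-not-root w = ∑-zero (allVecs entries n) (λ V → rootedWeight-nonRoot α d y v (insertAt V v (just w)) (VecP.insertAt-lookup V v (just w)))

forestSum-suc : ∀ n α d y → forestSum (suc n) α d y ≡ ∑ (forests n) (adjoinedWeight n α d y)
forestSum-suc n α d y = ℕ→ℚ-suc-*-cancelˡ n (begin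
    ℕ→ℚ (suc n) * forestSum (suc n) α d y
  ≡⟨ ∑-rootedWeight (suc n) α d y ⟩
    ∑[ v ∈ allFin (suc n) ] ∑ (allVecs (allMaybeFin (suc n)) (suc n)) (rootedWeight α d y v)
  ≡⟨ ∑-cong (allFin (suc n)) (∑-rootedWeight-at n α d y) ⟩
    ∑[ v ∈ allFin (suc n) ] ∑ (forests n) (adjoinedWeight n α d y)
  ≡⟨ ∑-allFin-const (suc n) _ ⟩
    ℕ→ℚ (suc n) * ∑ (forests n) (adjoinedWeight n α d y)
  ∎)
  where open ≡-Reasoning

∑-forests-cong : ∀ n {f g : ParentMap n → ℚ} → (∀ F → isForest F → f F ≡ g F) → ∑ (forests n) f ≡ ∑ (forests n) g
∑-forests-cong n {f} {g} f≡g = begin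
    ∑ (forests n) f                       ≡⟨ ∑-filter isForest? Fs f ⟩
    ∑[ F ∈ Fs ] (𝟙 (isForest? F) * f F)   ≡⟨ ∑-cong Fs (λ F → 𝟙-* (isForest? F) (f F) (g F) (f≡g F ∘ isForest?-sound F)) ⟩
    ∑[ F ∈ Fs ] (𝟙 (isForest? F) * g F)   ≡⟨ ∑-filter isForest? Fs g ⟨
    ∑ (forests n) g                       ∎
  where
  open ≡-Reasoning
  Fs = allVecs (allMaybeFin n) n

tree-pos : ∀ {n} (G : ParentMap (suc n)) → isForest G → ∃ λ k → tree G ≡ suc k
tree-pos G forest = count-pos (λ u → isRoot? (lookup G u)) (rootOf G forest zero)
  (isRoot?-true (rootOf-isRoot G forest zero))

-- A nonempty forest has a root, so the factor (1 + y) ^ (tree G - 1) can be split off.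
forestSum-suc-suc : ∀ m α d y →
  forestSum (suc (suc m)) α d y ≡ (d * ((1ℚ + α) * (1ℚ + y) + ℕ→ℚ (suc m))) * forestSum (suc m) α 1ℚ (1ℚ + y)
forestSum-suc-suc m α d y = begin
    forestSum (suc (suc m)) α d y
  ≡⟨ forestSum-suc (suc m) α d y ⟩
    ∑ (forests (suc m)) (adjoinedWeight (suc m) α d y)
  ≡⟨ ∑-forests-cong (suc m) (λ G forest → factor G (tree-pos G forest)) ⟩
    ∑[ G ∈ forests (suc m) ] (K * weight α 1ℚ (1ℚ + y) G)
  ≡⟨ *-distribˡ-∑ K (forests (suc m)) (weight α 1ℚ (1ℚ + y)) ⟨
    K * forestSum (suc m) α 1ℚ (1ℚ + y)
  ∎ where
  open ≡-Reasoning
  K = d * ((1ℚ + α) * (1ℚ + y) + ℕ→ℚ (suc m))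
  factor : ∀ G → (∃ λ k → tree G ≡ suc k) → adjoinedWeight (suc m) α d y G ≡ K * weight α 1ℚ (1ℚ + y) G
  factor G (k , tree≡1+k) = begin
      d * (W * ((1ℚ + α) * (1ℚ + y) ^ tree G + ℕ→ℚ (suc m) * (1ℚ + y) ^ (tree G ∸ 1)))
    ≡⟨ cong (λ t → d * (W * ((1ℚ + α) * (1ℚ + y) ^ t + ℕ→ℚ (suc m) * (1ℚ + y) ^ (t ∸ 1)))) tree≡1+k ⟩
      d * (W * ((1ℚ + α) * ((1ℚ + y) * (1ℚ + y) ^ k) + ℕ→ℚ (suc m) * (1ℚ + y) ^ k))
    ≡⟨ solve 6 (λ d w a y s z → d :* (w :* (a :* ((con 1ℚ :+ y) :* z) :+ s :* z)) := (d :* (a :* (con 1ℚ :+ y) :+ s)) :* ((con 1ℚ :* z) :* w)) refl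
         d W (1ℚ + α) y (ℕ→ℚ (suc m)) ((1ℚ + y) ^ k) ⟩
      K * (rootWeight 1ℚ (1ℚ + y) (suc k) * W)
    ≡⟨ cong (λ t → K * (rootWeight 1ℚ (1ℚ + y) t * W)) tree≡1+k ⟨
      K * weight α 1ℚ (1ℚ + y) G
    ∎ where W = hookWeight α G

-- The closed form

-- The i-th factor of P (suc m) 1ℚ (1ℚ + α) (y * (1ℚ + α)).
Pfactor : ℕ → ℚ → ℚ → ℕ → ℚ
Pfactor m α y i = ℕ→ℚ i * 1ℚ + ℕ→ℚ (suc m ∸ i) * (1ℚ + α) + y * (1ℚ + α)

Pfactor-suc : ∀ m α y i → i ≤ m → Pfactor m α (1ℚ + y) (suc i) ≡ Pfactor (suc m) α y (suc i)
Pfactor-suc m α y i i≤m = begin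
    ℕ→ℚ (suc i) * 1ℚ + ℕ→ℚ (m ∸ i) * b + (1ℚ + y) * b
  ≡⟨ solve 4 (λ a c b y → a :+ c :* b :+ (con 1ℚ :+ y) :* b := a :+ (con 1ℚ :+ c) :* b :+ y :* b) refl (ℕ→ℚ (suc i) * 1ℚ) (ℕ→ℚ (m ∸ i)) b y ⟩
    ℕ→ℚ (suc i) * 1ℚ + (1ℚ + ℕ→ℚ (m ∸ i)) * b + y * b
  ≡⟨ cong (λ z → ℕ→ℚ (suc i) * 1ℚ + z * b + y * b) (trans (cong ℕ→ℚ (ℕP.+-∸-assoc 1 i≤m)) (ℕ→ℚ-suc (m ∸ i))) ⟨
    ℕ→ℚ (suc i) * 1ℚ + ℕ→ℚ (suc m ∸ i) * b + y * b
  ∎ where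
  open ≡-Reasoning
  b = 1ℚ + α

∏-applyUpTo-cong : (f : ℕ → A) (m : ℕ) {g h : A → ℚ} → (∀ i → i < m → g (f i) ≡ h (f i)) →
  ∏ (applyUpTo f m) g ≡ ∏ (applyUpTo f m) h
∏-applyUpTo-cong f zero g≡h = refl
∏-applyUpTo-cong f (suc m) g≡h = cong₂ _*_ (g≡h 0 (s≤s z≤n)) (∏-applyUpTo-cong (f ∘ suc) m (λ i i<m → g≡h (suc i) (s≤s i<m)))

forestSum-closed : ∀ m α d y → forestSum (suc m) α d y ≡ d * ((1ℚ + α) * ∏ (applyUpTo suc m) (Pfactor m α y))
forestSum-closed zero α d y = trans (forestSum-suc 0 α d y)
  (solve 2 (λ d b → d :* (con 1ℚ :* (b :* con 1ℚ :+ con 0ℚ :* con 1ℚ)) :+ con 0ℚ := d :* (b :* con 1ℚ)) refl d (1ℚ + α))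
forestSum-closed (suc m) α d y = begin
    forestSum (suc (suc m)) α d y
  ≡⟨ forestSum-suc-suc m α d y ⟩
    (d * (b * (1ℚ + y) + ℕ→ℚ (suc m))) * forestSum (suc m) α 1ℚ (1ℚ + y)
  ≡⟨ cong ((d * (b * (1ℚ + y) + ℕ→ℚ (suc m))) *_) (forestSum-closed m α 1ℚ (1ℚ + y)) ⟩
    (d * (b * (1ℚ + y) + ℕ→ℚ (suc m))) * (1ℚ * (b * ∏ (applyUpTo suc m) (Pfactor m α (1ℚ + y))))
  ≡⟨ cong (λ z → (d * (b * (1ℚ + y) + ℕ→ℚ (suc m))) * (1ℚ * (b * z)))
       (∏-applyUpTo-cong suc m (λ i i<m → Pfactor-suc m α y i (ℕP.<⇒≤ i<m))) ⟩
    (d * (b * (1ℚ + y) + ℕ→ℚ (suc m))) * (1ℚ * (b * Q))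
  ≡⟨ solve 5 (λ d b y s q → (d :* (b :* (con 1ℚ :+ y) :+ s)) :* (con 1ℚ :* (b :* q)) := d :* (b :* (q :* (s :* con 1ℚ :+ con 1ℚ :* b :+ y :* b)))) refl
       d b y (ℕ→ℚ (suc m)) Q ⟩
    d * (b * (Q * (ℕ→ℚ (suc m) * 1ℚ + 1ℚ * b + y * b)))
  ≡⟨ cong (λ t → d * (b * (Q * (ℕ→ℚ (suc m) * 1ℚ + ℕ→ℚ t * b + y * b)))) (ℕP.m+n∸n≡m 1 (suc m)) ⟨
    d * (b * (Q * Pfactor (suc m) α y (suc m)))
  ≡⟨ cong (λ z → d * (b * z)) (trans (cong (λ is → ∏ is (Pfactor (suc m) α y)) (sym (ListP.applyUpTo-∷ʳ suc m)))
        (trans (∏-++ (applyUpTo suc m) (suc m ∷ []) (Pfactor (suc m) α y)) (cong (Q *_) (ℚP.*-identityʳ _)))) ⟨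
    d * (b * ∏ (applyUpTo suc (suc m)) (Pfactor (suc m) α y))
  ∎ where
  open ≡-Reasoning
  b = 1ℚ + α
  Q = ∏ (applyUpTo suc m) (Pfactor (suc m) α y)

^≡rootWeight : ∀ c k → c ^ k ≡ rootWeight c c k
^≡rootWeight c zero = refl
^≡rootWeight c (suc k) = refl

corollary6p3 : (n : ℕ) (α c : ℚ) →
    LHS n α c ≡ P n 1ℚ (1ℚ + α) (c * (1ℚ + α))
corollary6p3 zero α c = refl
corollary6p3 (suc m) α c = begin
    LHS (suc m) α c
  ≡⟨ ∑-cong (forests (suc m)) (λ F → cong (_* hookWeight α F) (^≡rootWeight c (tree F))) ⟩
    forestSum (suc m) α c c
  ≡⟨ forestSum-closed m α c c ⟩
    c * ((1ℚ + α) * ∏ (applyUpTo suc m) (Pfactor m α c))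
  ≡⟨ ℚP.*-assoc c (1ℚ + α) _ ⟨
    P (suc m) 1ℚ (1ℚ + α) (c * (1ℚ + α))
  ∎ where open ≡-Reasoning
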